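{- Let $m\ge 2$ be an integer and $n$ an even positive integer. If $m\equiv 0$ or $3\pmod 4$ and $n\equiv 2\pmod 4$, then there is no cyclic hamiltonian cycle system of $K_{m\times n}$.
   Context: $K_{m\times n}$ is the complete multipartite graph with $m$ parts of size $n$, with vertex set identified with $\mathbb{Z}_{mn}$, parts the cosets of $m\mathbb{Z}_{mn}$, and $x,y$ adjacent iff $x-y\notin m\mathbb{Z}_{mn}$. A hamiltonian cycle system is a set of cycles through all $mn$ vertices whose edge sets partition the edge set; it is cyclic if whenever $(c_0,\dots,c_{mn-1})$ belongs to it, so does $(c_0+1,\dots,c_{mn-1}+1)$. -}

module Defs where

open import Data.Nat using (ℕ; zero; suc; _+_; _*_; _<_; _≟_)
open import Data.Product using (Σ; ∃; _×_; _,_)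
open import Data.Sum using (_⊎_)
open import Data.List using (List; []; _∷_; length; map; drop; take; _++_; zip; reverse; lookup)
open import Data.List.Membership.Propositional using (_∈_)
open import Data.List.Relation.Unary.All using (All)
open import Data.List.Relation.Unary.Unique.Propositional using (Unique)
open import Data.Fin using (Fin)
open import Relation.Nullary using (¬_; yes; no)
open import Relation.Binary.PropositionalEquality using (_≡_)

-- Vertices of K_{m×n} are the naturals 0 … mn-1 (representatives of ℤ_{mn}).
-- x and y lie in the same part iff x - y ∈ mℤ (equivalently in mℤ_{mn}, as m ∣ mn).
SamePart : ℕ → ℕ → ℕ → Set
SamePart m x y = ∃ λ k → (x ≡ y + k * m) ⊎ (y ≡ x + k * m)

Adj : ℕ → ℕ → ℕ → Set
Adj m x y = ¬ SamePart m x y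

succMod : ℕ → ℕ → ℕ
succMod N x with suc x ≟ N
... | yes _ = 0
... | no _ = suc x

rotate : {A : Set} → ℕ → List A → List A
rotate k xs = drop k xs ++ take k xs

steps : List ℕ → List (ℕ × ℕ)
steps c = zip c (rotate 1 c)

EdgeOf : ℕ → ℕ → List ℕ → Set
EdgeOf x y c = ((x , y) ∈ steps c) ⊎ ((y , x) ∈ steps c)

HamCycle : ℕ → ℕ → List ℕ → Set
HamCycle m n c =
  (length c ≡ m * n) × Unique c × All (λ x → x < m * n) c
  × All (λ p → Adj m (Data.Product.proj₁ p) (Data.Product.proj₂ p)) (steps c)

SameCycle : List ℕ → List ℕ → Set
SameCycle c d = ∃ λ k → (d ≡ rotate k c) ⊎ (d ≡ rotate k (reverse c))

HCS : ℕ → ℕ → List (List ℕ) → Set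
HCS m n Cs =
  All (HamCycle m n) Cs ×
  (∀ x y → x < m * n → y < m * n → Adj m x y →
     Σ (Fin (length Cs)) λ i → EdgeOf x y (lookup Cs i) ×
       (∀ j → EdgeOf x y (lookup Cs j) → j ≡ i))

CyclicHCS : ℕ → ℕ → List (List ℕ) → Set
CyclicHCS m n Cs =
  HCS m n Cs ×
  (∀ c → c ∈ Cs → ∃ λ d → d ∈ Cs × SameCycle d (map (succMod (m * n)) c))

module Submission where

-- Write n = 2t with t odd, N = mn = 2h with h = tm, and let T v = v + h be the
-- half turn of ℤ_N. As m ∣ h, T is a fixed-point-free involution preserving
-- the parts. Each edge gets a weight in {0, 1} (crossWeight) such that an edge
-- and its image under T have weights adding up to 1 if they cross between the
-- halves [0, h) and [h, N), and to 0 otherwise. Since a closed walk crosses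
-- an even number of times, T preserves the parity of the weight of a
-- hamiltonian cycle, and a cycle mapped onto itself by T has odd weight.
-- In a cyclic system T permutes the K cycles by an involution, so the pairing
-- argument makes Σ_k (weight of cycle k + 1) even. But the cycles partition
-- the edges: the weights add up to the number B of edges of K_{m×t}, and
-- counting edges gives K = t(m - 1). For m ≡ 0, 3 (mod 4), B + K is odd.

open import Defs
open import Data.Nat
open import Data.Nat.Properties
open import Algebra.Properties.CommutativeSemigroup +-commutativeSemigroup using (interchange; xy∙z≈xz∙y)
open import Data.Nat.DivMod
open import Data.Nat.Divisibility using (_∣_; divides; ∣m∣n⇒∣m+n)
open import Data.Nat.GeneralisedArithmetic using (fold)
open import Data.Nat.Tactic.RingSolver using (solve-∀)
open import Data.Parity.Base using (Parity; 0ℙ; 1ℙ) renaming (_+_ to _⊕_)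
import Data.Parity.Properties as ℙ
open import Data.Bool using (if_then_else_)
open import Data.List using (List; []; _∷_; length; map; drop; take; _++_; zip; reverse; lookup)
open import Data.List.Properties using (unfold-reverse; length-reverse; length-drop; length-++; length-zipWith; drop-all; take-all)
open import Data.List.Membership.Propositional using (_∈_)
open import Data.List.Relation.Unary.Any using (here; there)
open import Data.List.Relation.Unary.All as All using (All)
open import Data.List.Relation.Unary.Unique.Propositional using (Unique)
open import Data.List.Relation.Unary.AllPairs using ([]; _∷_)
open import Data.Fin using (Fin; toℕ; fromℕ<) renaming (zero to fzero; suc to fsuc)
open import Data.Fin.Properties using (toℕ-fromℕ<; toℕ<n)
open import Data.Product using (Σ; ∃; _×_; _,_; proj₁; proj₂)
open import Data.Sum using (_⊎_; inj₁; inj₂)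
open import Data.Empty using (⊥; ⊥-elim)
open import Relation.Nullary using (¬_; Dec; yes; no; does)
open import Relation.Nullary.Decidable using (dec-true; dec-false)
open import Relation.Nullary.Decidable.Core using (¬?)
open import Relation.Binary.Definitions using (tri<; tri≈; tri>)
open import Relation.Binary.PropositionalEquality hiding ([_])

[_] : {P : Set} → Dec P → ℕ
[ yes _ ] = 1
[ no _ ] = 0

Σ< : ℕ → (ℕ → ℕ) → ℕ
Σ< zero f = 0
Σ< (suc n) f = Σ< n f + f n

sum-cong : ∀ n {f g : ℕ → ℕ} → (∀ i → i < n → f i ≡ g i) → Σ< n f ≡ Σ< n g
sum-cong zero e = refl
sum-cong (suc n) e = cong₂ _+_ (sum-cong n (λ i p → e i (m≤n⇒m≤1+n p))) (e n ≤-refl)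

sum-zero : ∀ n {f : ℕ → ℕ} → (∀ i → i < n → f i ≡ 0) → Σ< n f ≡ 0
sum-zero zero e = refl
sum-zero (suc n) e rewrite sum-zero n (λ i p → e i (m≤n⇒m≤1+n p)) = e n ≤-refl

sum-const : ∀ n c → Σ< n (λ _ → c) ≡ n * c
sum-const zero c = refl
sum-const (suc n) c rewrite sum-const n c = +-comm (n * c) c

sum-+ : ∀ n (f g : ℕ → ℕ) → Σ< n (λ i → f i + g i) ≡ Σ< n f + Σ< n g
sum-+ zero f g = refl
sum-+ (suc n) f g rewrite sum-+ n f g = interchange (Σ< n f) (Σ< n g) (f n) (g n)

sum-*ˡ : ∀ n c (f : ℕ → ℕ) → Σ< n (λ i → c * f i) ≡ c * Σ< n f
sum-*ˡ zero c f = sym (*-zeroʳ c)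
sum-*ˡ (suc n) c f rewrite sum-*ˡ n c f = sym (*-distribˡ-+ c (Σ< n f) (f n))

sum-*ʳ : ∀ n c (f : ℕ → ℕ) → Σ< n (λ i → f i * c) ≡ Σ< n f * c
sum-*ʳ n c f = begin
  Σ< n (λ i → f i * c) ≡⟨ sum-cong n (λ i _ → *-comm (f i) c) ⟩
  Σ< n (λ i → c * f i) ≡⟨ sum-*ˡ n c f ⟩
  c * Σ< n f           ≡⟨ *-comm c (Σ< n f) ⟩
  Σ< n f * c           ∎
  where open ≡-Reasoning

sum-split : ∀ a b (f : ℕ → ℕ) → Σ< (a + b) f ≡ Σ< a f + Σ< b (λ i → f (a + i))
sum-split a zero f rewrite +-identityʳ a = sym (+-identityʳ _)
sum-split a (suc b) f rewrite +-suc a b | sum-split a b f =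
  +-assoc (Σ< a f) (Σ< b (λ i → f (a + i))) (f (a + b))

sum-swap : ∀ n k (f : ℕ → ℕ → ℕ) →
  Σ< n (λ i → Σ< k (f i)) ≡ Σ< k (λ j → Σ< n (λ i → f i j))
sum-swap zero k f = sym (sum-zero k (λ _ _ → refl))
sum-swap (suc n) k f rewrite sum-swap n k f = sym (sum-+ k (λ j → Σ< n (λ i → f i j)) (f n))

sum-point : ∀ n (f : ℕ → ℕ) p → p < n → (∀ i → i < n → i ≢ p → f i ≡ 0) → Σ< n f ≡ f p
sum-point (suc n) f p p<n e with p ≟ n
... | yes refl rewrite sum-zero n (λ i i<n → e i (m≤n⇒m≤1+n i<n) (λ q → <-irrefl q i<n)) = refl
... | no p≢n rewrite e n ≤-refl (λ q → p≢n (sym q)) | +-identityʳ (Σ< n f) =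
  sum-point n f p (≤∧≢⇒< (≤-pred p<n) p≢n) (λ i i<n → e i (m≤n⇒m≤1+n i<n))

sum-indicator : ∀ n u (f : ℕ → ℕ) → u < n → Σ< n (λ x → [ u ≟ x ] * f x) ≡ f u
sum-indicator n u f u<n = trans (sum-point n (λ x → [ u ≟ x ] * f x) u u<n off) at-u
  where
  off : ∀ i → i < n → i ≢ u → [ u ≟ i ] * f i ≡ 0
  off i _ i≢u with u ≟ i
  ... | yes u≡i = ⊥-elim (i≢u (sym u≡i))
  ... | no _ = refl
  at-u : [ u ≟ u ] * f u ≡ f u
  at-u with u ≟ u
  ... | yes _ = +-identityʳ (f u)
  ... | no u≢u = ⊥-elim (u≢u refl)

sum-nonzero : ∀ n (f : ℕ → ℕ) → Σ< n f ≢ 0 → ∃ λ i → i < n × f i ≢ 0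
sum-nonzero zero f nz = ⊥-elim (nz refl)
sum-nonzero (suc n) f nz with f n ≟ 0
... | no fn≢0 = n , ≤-refl , fn≢0
... | yes fn≡0 with sum-nonzero n f (λ s≡0 → nz (cong₂ _+_ s≡0 fn≡0))
...   | i , i<n , fi≢0 = i , m≤n⇒m≤1+n i<n , fi≢0

-- Case analysis on i = j (leaving i ≟ j unabstracted in the goal).
≟-cases : ∀ {A : Set} i j → (i ≡ j → A) → (i ≢ j → A) → A
≟-cases i j same other with i ≟ j
... | yes i≡j = same i≡j
... | no i≢j = other i≢j

update : (ℕ → ℕ) → ℕ → ℕ → ℕ → ℕ
update f j v i with i ≟ j
... | yes _ = v
... | no _ = f i

update-same : ∀ f j v → update f j v j ≡ v
update-same f j v with j ≟ j
... | yes _ = refl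
... | no j≢j = ⊥-elim (j≢j refl)

update-other : ∀ f j v i → i ≢ j → update f j v i ≡ f i
update-other f j v i i≢j with i ≟ j
... | yes i≡j = ⊥-elim (i≢j i≡j)
... | no _ = refl

sum-extract : ∀ n f j → j < n → Σ< n f ≡ Σ< n (update f j 0) + f j
sum-extract (suc n) f j j<n with j ≟ n
... | yes refl rewrite update-same f j 0 | +-identityʳ (Σ< j (update f j 0)) =
  cong (_+ f j) (sum-cong j (λ i i<j → sym (update-other f j 0 i (λ e → <-irrefl e i<j))))
... | no j≢n rewrite update-other f j 0 n (λ e → j≢n (sym e))
                   | sum-extract n f j (≤∧≢⇒< (≤-pred j<n) j≢n) =
  xy∙z≈xz∙y (Σ< n (update f j 0)) (f j) (f n)

bit : Parity → ℕ
bit 0ℙ = 0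
bit 1ℙ = 1

parity-bit : ∀ p → parity (bit p) ≡ p
parity-bit 0ℙ = refl
parity-bit 1ℙ = refl

⊕≡0ℙ⇒≡ : ∀ p q → p ⊕ q ≡ 0ℙ → p ≡ q
⊕≡0ℙ⇒≡ p q p⊕q≡0 = ℙ.+-cancelʳ-≡ q p q (trans p⊕q≡0 (sym (ℙ.p+p≡0ℙ q)))

+-double-injective : ∀ a b → a + a ≡ b + b → a ≡ b
+-double-injective a b e with <-cmp a b
... | tri≈ _ a≡b _ = a≡b
... | tri< a<b _ _ = ⊥-elim (<-irrefl e (+-mono-< a<b a<b))
... | tri> _ _ b<a = ⊥-elim (<-irrefl (sym e) (+-mono-< b<a b<a))

even-or-odd : ∀ q → ∃ λ k → q ≡ k + k ⊎ q ≡ suc (k + k)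
even-or-odd zero = 0 , inj₁ refl
even-or-odd (suc q) with even-or-odd q
... | k , inj₁ e = k , inj₂ (cong suc e)
... | k , inj₂ e = suc k , inj₁ (cong suc (trans e (sym (+-suc k k))))

record Involution (K : ℕ) (τ : ℕ → ℕ) : Set where
  field
    closed : ∀ k → k < K → τ k < K
    involutive : ∀ k → k < K → τ (τ k) ≡ k

-- Removing the top element K from an involution of {0, …, K}: if K is fixed,
-- τ itself restricts to {0, …, K - 1}; otherwise its partner τ K is made a
-- fixed point.
module _ {K : ℕ} {τ : ℕ → ℕ} (inv : Involution (suc K) τ) where
  open Involution inv

  private
    below : ∀ {k} → k < K → k < suc K
    below = m<n⇒m<1+n

  stays-below : ∀ k → k < K → k ≢ τ K → τ k < K
  stays-below k k<K k≢τK = ≤∧≢⇒< (≤-pred (closed k (below k<K)))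
    (λ τk≡K → k≢τK (trans (sym (involutive k (below k<K))) (cong τ τk≡K)))

  not-to-partner : ∀ k → k < K → τ k ≢ τ K
  not-to-partner k k<K τk≡τK =
    <-irrefl (trans (sym (involutive k (below k<K))) (trans (cong τ τk≡τK) (involutive K ≤-refl))) k<K

  partner-below : τ K ≢ K → τ K < K
  partner-below moved = ≤∧≢⇒< (≤-pred (closed K ≤-refl)) moved

  drop-fixed : τ K ≡ K → Involution K τ
  drop-fixed fixed = record
    { closed = λ k k<K → stays-below k k<K (λ k≡τK → <-irrefl (trans k≡τK fixed) k<K)
    ; involutive = λ k k<K → involutive k (below k<K) }

  drop-pair : Involution K (update τ (τ K) (τ K))
  drop-pair = record { closed = closed′ ; involutive = involutive′ }
    where
    j : ℕ
    j = τ K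
    τ′ : ℕ → ℕ
    τ′ = update τ j j
    closed′ : ∀ k → k < K → τ′ k < K
    closed′ k k<K = ≟-cases k j
      (λ { refl → subst (_< K) (sym (update-same τ j j)) k<K })
      (λ k≢j → subst (_< K) (sym (update-other τ j j k k≢j)) (stays-below k k<K k≢j))
    involutive′ : ∀ k → k < K → τ′ (τ′ k) ≡ k
    involutive′ k k<K = ≟-cases k j
      (λ { refl → trans (cong τ′ (update-same τ j j)) (update-same τ j j) })
      (λ k≢j → trans (cong τ′ (update-other τ j j k k≢j))
                 (trans (update-other τ j j (τ k) (not-to-partner k k<K)) (involutive k (below k<K))))

-- Pairing argument: if u is even at the fixed points of an involution τ and
-- u k ≡ u (τ k) mod 2, then Σ u is even, since the other terms pair up.
pairing-even : ∀ K (u τ : ℕ → ℕ) → Involution K τ →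
  (∀ k → k < K → τ k ≡ k → parity (u k) ≡ 0ℙ) →
  (∀ k → k < K → parity (u k) ≡ parity (u (τ k))) →
  parity (Σ< K u) ≡ 0ℙ
pairing-even zero u τ inv even-fixed same-parity = refl
pairing-even (suc K) u τ inv even-fixed same-parity with τ K ≟ K
... | yes fixed = begin
  parity (Σ< K u + u K)           ≡⟨ ℙ.+-homo-+ (Σ< K u) (u K) ⟩
  parity (Σ< K u) ⊕ parity (u K)  ≡⟨ cong₂ _⊕_ rest (even-fixed K ≤-refl fixed) ⟩
  0ℙ                              ∎
  where
  open ≡-Reasoning
  rest : parity (Σ< K u) ≡ 0ℙ
  rest = pairing-even K u τ (drop-fixed inv fixed)
    (λ k k<K → even-fixed k (m<n⇒m<1+n k<K)) (λ k k<K → same-parity k (m<n⇒m<1+n k<K))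
... | no moved = begin
  parity (Σ< K u + u K)
    ≡⟨ cong (λ s → parity (s + u K)) (sum-extract K u j (partner-below inv moved)) ⟩
  parity (Σ< K u′ + u j + u K)
    ≡⟨ ℙ.+-homo-+ (Σ< K u′ + u j) (u K) ⟩
  parity (Σ< K u′ + u j) ⊕ parity (u K)
    ≡⟨ cong (_⊕ parity (u K)) (ℙ.+-homo-+ (Σ< K u′) (u j)) ⟩
  (parity (Σ< K u′) ⊕ parity (u j)) ⊕ parity (u K)
    ≡⟨ cong₂ (λ a b → (a ⊕ parity (u j)) ⊕ b) rest (same-parity K ≤-refl) ⟩
  (0ℙ ⊕ parity (u j)) ⊕ parity (u j)
    ≡⟨ ℙ.p+p≡0ℙ (parity (u j)) ⟩
  0ℙ ∎
  where
  open ≡-Reasoning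
  -- the pair {j, K} is removed: j becomes a fixed point and u j is set to 0
  j : ℕ
  j = τ K
  u′ τ′ : ℕ → ℕ
  u′ = update u j 0
  τ′ = update τ j j
  even-fixed′ : ∀ k → k < K → τ′ k ≡ k → parity (u′ k) ≡ 0ℙ
  even-fixed′ k k<K τ′k≡k = ≟-cases k j
    (λ { refl → cong parity (update-same u k 0) })
    (λ k≢j → trans (cong parity (update-other u j 0 k k≢j))
               (even-fixed k (m<n⇒m<1+n k<K) (trans (sym (update-other τ j j k k≢j)) τ′k≡k)))
  same-parity′ : ∀ k → k < K → parity (u′ k) ≡ parity (u′ (τ′ k))
  same-parity′ k k<K = ≟-cases k j
    (λ { refl → cong (λ i → parity (u′ i)) (sym (update-same τ k k)) })
    (λ k≢j → begin
      parity (u′ k)       ≡⟨ cong parity (update-other u j 0 k k≢j) ⟩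
      parity (u k)        ≡⟨ same-parity k (m<n⇒m<1+n k<K) ⟩
      parity (u (τ k))    ≡⟨ cong parity (sym (update-other u j 0 (τ k) (not-to-partner inv k k<K))) ⟩
      parity (u′ (τ k))   ≡⟨ cong (λ i → parity (u′ i)) (sym (update-other τ j j k k≢j)) ⟩
      parity (u′ (τ′ k))  ∎)
  rest : parity (Σ< K u′) ≡ 0ℙ
  rest = pairing-even K u′ τ′ (drop-pair inv) even-fixed′ same-parity′

<-indicators : ∀ a b → a ≢ b → [ a <? b ] + [ b <? a ] ≡ 1
<-indicators a b a≢b with a <? b | b <? a
... | yes a<b | yes b<a = ⊥-elim (<-asym a<b b<a)
... | yes _ | no _ = refl
... | no _ | yes _ = refl
... | no a≮b | no b≮a = ⊥-elim (a≢b (≤-antisym (≮⇒≥ b≮a) (≮⇒≥ a≮b)))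

ordered-pick : ∀ u v (g : ℕ → ℕ → ℕ) → u ≢ v → g u v ≡ g v u →
  [ u <? v ] * g u v + [ v <? u ] * g v u ≡ g u v
ordered-pick u v g u≢v sym-g = begin
  [ u <? v ] * g u v + [ v <? u ] * g v u ≡⟨ cong ([ u <? v ] * g u v +_) (cong ([ v <? u ] *_) (sym sym-g)) ⟩
  [ u <? v ] * g u v + [ v <? u ] * g u v ≡⟨ sym (*-distribʳ-+ (g u v) [ u <? v ] [ v <? u ]) ⟩
  ([ u <? v ] + [ v <? u ]) * g u v      ≡⟨ cong (_* g u v) (<-indicators u v u≢v) ⟩
  1 * g u v                              ≡⟨ *-identityˡ (g u v) ⟩
  g u v                                  ∎
  where open ≡-Reasoning

pair-indicator-sum : ∀ n u v (g : ℕ → ℕ → ℕ) → u < n → v < n →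
  Σ< n (λ x → Σ< n (λ y → [ x <? y ] * ([ u ≟ x ] * [ v ≟ y ] + [ u ≟ y ] * [ v ≟ x ]) * g x y))
  ≡ [ u <? v ] * g u v + [ v <? u ] * g v u
pair-indicator-sum n u v g u<n v<n = begin
  Σ< n (λ x → Σ< n (λ y → [ x <? y ] * ([ u ≟ x ] * [ v ≟ y ] + [ u ≟ y ] * [ v ≟ x ]) * g x y))
    ≡⟨ sum-cong n (λ x _ → sum-cong n (λ y _ → distribute [ x <? y ] [ u ≟ x ] [ v ≟ y ] [ u ≟ y ] [ v ≟ x ] (g x y))) ⟩
  Σ< n (λ x → Σ< n (λ y → [ u ≟ x ] * ([ v ≟ y ] * G x y) + [ v ≟ x ] * ([ u ≟ y ] * G x y)))
    ≡⟨ sum-cong n (λ x _ → sum-+ n _ _) ⟩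
  Σ< n (λ x → Σ< n (λ y → [ u ≟ x ] * ([ v ≟ y ] * G x y)) + Σ< n (λ y → [ v ≟ x ] * ([ u ≟ y ] * G x y)))
    ≡⟨ sum-cong n (λ x _ → cong₂ _+_ (pick-y x u v v<n) (pick-y x v u u<n)) ⟩
  Σ< n (λ x → [ u ≟ x ] * G x v + [ v ≟ x ] * G x u)
    ≡⟨ sum-+ n _ _ ⟩
  Σ< n (λ x → [ u ≟ x ] * G x v) + Σ< n (λ x → [ v ≟ x ] * G x u)
    ≡⟨ cong₂ _+_ (sum-indicator n u (λ x → G x v) u<n) (sum-indicator n v (λ x → G x u) v<n) ⟩
  [ u <? v ] * g u v + [ v <? u ] * g v u ∎
  where
  open ≡-Reasoning
  G : ℕ → ℕ → ℕ
  G x y = [ x <? y ] * g x y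
  distribute : ∀ a b c d e f → a * (b * c + d * e) * f ≡ b * (c * (a * f)) + e * (d * (a * f))
  distribute = solve-∀
  pick-y : ∀ x a b → b < n → Σ< n (λ y → [ a ≟ x ] * ([ b ≟ y ] * G x y)) ≡ [ a ≟ x ] * G x b
  pick-y x a b b<n = trans (sum-*ˡ n [ a ≟ x ] _) (cong ([ a ≟ x ] *_) (sum-indicator n b (G x) b<n))

<-indicator-+ʳ : ∀ a b c → [ a + c <? b + c ] ≡ [ a <? b ]
<-indicator-+ʳ a b c with a + c <? b + c | a <? b
... | yes _ | yes _ = refl
... | no _ | no _ = refl
... | yes a+c<b+c | no a≮b = ⊥-elim (a≮b (+-cancelʳ-< c a b a+c<b+c))
... | no a+c≮b+c | yes a<b = ⊥-elim (a+c≮b+c (+-monoˡ-< c a<b))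

module _ (m : ℕ) .{{_ : NonZero m}} where

  samePart⇒%≡ : ∀ x y → SamePart m x y → x % m ≡ y % m
  samePart⇒%≡ x y (k , inj₁ refl) = [m+kn]%n≡m%n y k m
  samePart⇒%≡ x y (k , inj₂ refl) = sym ([m+kn]%n≡m%n x k m)

  private
    %≡⇒offset : ∀ x y → y ≤ x → x % m ≡ y % m → x ≡ y + (x / m ∸ y / m) * m
    %≡⇒offset x y y≤x e = begin
      x                                             ≡⟨ m≡m%n+[m/n]*n x m ⟩
      x % m + x / m * m                             ≡⟨ cong (_+ x / m * m) e ⟩
      y % m + x / m * m                             ≡⟨ cong (y % m +_) (sym (m+[n∸m]≡n y/m*m≤x/m*m)) ⟩
      y % m + (y / m * m + (x / m * m ∸ y / m * m)) ≡⟨ sym (+-assoc (y % m) _ _) ⟩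
      y % m + y / m * m + (x / m * m ∸ y / m * m)   ≡⟨ cong₂ _+_ (sym (m≡m%n+[m/n]*n y m)) (sym (*-distribʳ-∸ m (x / m) (y / m))) ⟩
      y + (x / m ∸ y / m) * m                       ∎
      where
      open ≡-Reasoning
      y/m*m≤x/m*m : y / m * m ≤ x / m * m
      y/m*m≤x/m*m = *-monoˡ-≤ m (/-monoˡ-≤ m y≤x)

  %≡⇒samePart : ∀ x y → x % m ≡ y % m → SamePart m x y
  %≡⇒samePart x y e with ≤-total y x
  ... | inj₁ y≤x = (x / m ∸ y / m) , inj₁ (%≡⇒offset x y y≤x e)
  ... | inj₂ x≤y = (y / m ∸ x / m) , inj₂ (%≡⇒offset y x x≤y (sym e))

  adj⇒%≢ : ∀ x y → Adj m x y → x % m ≢ y % m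
  adj⇒%≢ x y a e = a (%≡⇒samePart x y e)

  %≢⇒adj : ∀ x y → x % m ≢ y % m → Adj m x y
  %≢⇒adj x y ne s = ne (samePart⇒%≡ x y s)

nth : {A : Set} → A → List A → ℕ → A
nth d [] i = d
nth d (x ∷ xs) zero = x
nth d (x ∷ xs) (suc i) = nth d xs i

module _ {A : Set} (d : A) where

  ∈⇒nth : ∀ {x} {xs : List A} → x ∈ xs → ∃ λ i → i < length xs × nth d xs i ≡ x
  ∈⇒nth (here refl) = 0 , s≤s z≤n , refl
  ∈⇒nth (there p) with ∈⇒nth p
  ... | i , i< , e = suc i , s≤s i< , e

  nth∈ : ∀ (xs : List A) i → i < length xs → nth d xs i ∈ xs
  nth∈ (x ∷ xs) zero _ = here refl
  nth∈ (x ∷ xs) (suc i) (s≤s p) = there (nth∈ xs i p)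

  nth-lookup : ∀ (xs : List A) (i : Fin (length xs)) → lookup xs i ≡ nth d xs (toℕ i)
  nth-lookup (x ∷ xs) fzero = refl
  nth-lookup (x ∷ xs) (fsuc i) = nth-lookup xs i

  nth-++ˡ : ∀ (xs ys : List A) i → i < length xs → nth d (xs ++ ys) i ≡ nth d xs i
  nth-++ˡ (x ∷ xs) ys zero _ = refl
  nth-++ˡ (x ∷ xs) ys (suc i) (s≤s p) = nth-++ˡ xs ys i p

  nth-++ʳ : ∀ (xs ys : List A) i → nth d (xs ++ ys) (length xs + i) ≡ nth d ys i
  nth-++ʳ [] ys i = refl
  nth-++ʳ (x ∷ xs) ys i = nth-++ʳ xs ys i

  nth-drop : ∀ k (xs : List A) i → nth d (drop k xs) i ≡ nth d xs (k + i)
  nth-drop zero xs i = refl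
  nth-drop (suc k) [] i = refl
  nth-drop (suc k) (x ∷ xs) i = nth-drop k xs i

  nth-take : ∀ k (xs : List A) i → i < k → nth d (take k xs) i ≡ nth d xs i
  nth-take (suc k) [] i _ = refl
  nth-take (suc k) (x ∷ xs) zero _ = refl
  nth-take (suc k) (x ∷ xs) (suc i) (s≤s p) = nth-take k xs i p

  nth-reverse : ∀ (xs : List A) i → i < length xs → nth d (reverse xs) i ≡ nth d xs (length xs ∸ suc i)
  nth-reverse (x ∷ xs) i (s≤s i≤len) rewrite unfold-reverse x xs with i ≟ length xs
  ... | yes refl = begin
    nth d (reverse xs ++ x ∷ []) (length xs)         ≡⟨ cong (nth d (reverse xs ++ x ∷ [])) len-rev ⟩
    nth d (reverse xs ++ x ∷ []) (length (reverse xs) + 0) ≡⟨ nth-++ʳ (reverse xs) (x ∷ []) 0 ⟩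
    x                                                 ≡⟨ cong (nth d (x ∷ xs)) (sym (n∸n≡0 (length xs))) ⟩
    nth d (x ∷ xs) (length xs ∸ length xs)            ∎
    where
    open ≡-Reasoning
    len-rev : length xs ≡ length (reverse xs) + 0
    len-rev = trans (sym (length-reverse xs)) (sym (+-identityʳ _))
  ... | no i≢len = begin
    nth d (reverse xs ++ x ∷ []) i     ≡⟨ nth-++ˡ (reverse xs) (x ∷ []) i (subst (i <_) (sym (length-reverse xs)) i<len) ⟩
    nth d (reverse xs) i               ≡⟨ nth-reverse xs i i<len ⟩
    nth d xs (length xs ∸ suc i)       ≡⟨ cong (nth d (x ∷ xs)) (sym (+-∸-assoc 1 i<len)) ⟩
    nth d (x ∷ xs) (length xs ∸ i)     ∎
    where
    open ≡-Reasoning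
    i<len : i < length xs
    i<len = ≤∧≢⇒< i≤len i≢len

  nth-injective : ∀ (xs : List A) → Unique xs → ∀ i j → i < length xs → j < length xs →
    nth d xs i ≡ nth d xs j → i ≡ j
  nth-injective (x ∷ xs) (x∉ ∷ u) zero zero _ _ _ = refl
  nth-injective (x ∷ xs) (x∉ ∷ u) zero (suc j) _ (s≤s q) e = ⊥-elim (All.lookup x∉ (nth∈ xs j q) e)
  nth-injective (x ∷ xs) (x∉ ∷ u) (suc i) zero (s≤s p) _ e = ⊥-elim (All.lookup x∉ (nth∈ xs i p) (sym e))
  nth-injective (x ∷ xs) (x∉ ∷ u) (suc i) (suc j) (s≤s p) (s≤s q) e = cong suc (nth-injective xs u i j p q e)

nth-map : {A B : Set} (f : A → B) (d : A) (d′ : B) (xs : List A) (i : ℕ) → i < length xs →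
  nth d′ (map f xs) i ≡ f (nth d xs i)
nth-map f d d′ (x ∷ xs) zero _ = refl
nth-map f d d′ (x ∷ xs) (suc i) (s≤s p) = nth-map f d d′ xs i p

nth-zip : {A B : Set} (a : A) (b : B) (xs : List A) (ys : List B) (i : ℕ) → i < length xs → i < length ys →
  nth (a , b) (zip xs ys) i ≡ (nth a xs i , nth b ys i)
nth-zip a b (x ∷ xs) (y ∷ ys) zero _ _ = refl
nth-zip a b (x ∷ xs) (y ∷ ys) (suc i) (s≤s p) (s≤s q) = nth-zip a b xs ys i p q

module MultipartiteCounting (m' : ℕ) where

  m : ℕ
  m = suc m'

  adjInd : ℕ → ℕ → ℕ
  adjInd x y = [ ¬? (x % m ≟ y % m) ]

  adjInd-sym : ∀ x y → adjInd x y ≡ adjInd y x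
  adjInd-sym x y with x % m ≟ y % m | y % m ≟ x % m
  ... | yes _ | yes _ = refl
  ... | no _  | no _  = refl
  ... | yes p | no q  = ⊥-elim (q (sym p))
  ... | no p  | yes q = ⊥-elim (p (sym q))

  adjInd-self : ∀ x → adjInd x x ≡ 0
  adjInd-self x with x % m ≟ x % m
  ... | yes _ = refl
  ... | no x≢x = ⊥-elim (x≢x refl)

  adjInd-complement : ∀ x y → adjInd x y + [ x % m ≟ y % m ] ≡ 1
  adjInd-complement x y with x % m ≟ y % m
  ... | yes _ = refl
  ... | no _ = refl

  edgeTotal : ℕ → (ℕ → ℕ → ℕ) → ℕ
  edgeTotal L g = Σ< L (λ x → Σ< L (λ y → [ x <? y ] * adjInd x y * g x y))

  edgeCount : ℕ → ℕ
  edgeCount L = Σ< L (λ x → Σ< L (λ y → [ x <? y ] * adjInd x y))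

  residue-count : ∀ r s → r < m → Σ< (s * m) (λ y → [ r ≟ y % m ]) ≡ s
  residue-count r zero r<m = refl
  residue-count r (suc s) r<m = begin
    Σ< (m + s * m) (λ y → [ r ≟ y % m ])                                   ≡⟨ sum-split m (s * m) _ ⟩
    Σ< m (λ y → [ r ≟ y % m ]) + Σ< (s * m) (λ y → [ r ≟ (m + y) % m ])    ≡⟨ cong₂ _+_ first-block (sum-cong (s * m) (λ y _ → cong (λ z → [ r ≟ z ]) (m+y%m y))) ⟩
    1 + Σ< (s * m) (λ y → [ r ≟ y % m ])                                   ≡⟨ cong suc (residue-count r s r<m) ⟩
    suc s                                                                  ∎
    where
    open ≡-Reasoning
    m+y%m : ∀ y → (m + y) % m ≡ y % m
    m+y%m y = trans (cong (_% m) (+-comm m y)) ([m+n]%n≡m%n y m)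
    first-block : Σ< m (λ y → [ r ≟ y % m ]) ≡ 1
    first-block = trans (sum-cong m (λ y y<m → trans (cong (λ z → [ r ≟ z ]) (m<n⇒m%n≡m y<m)) (sym (*-identityʳ _))))
                        (sum-indicator m r (λ _ → 1) r<m)

  degree : ∀ x s → Σ< (s * m) (λ y → adjInd x y) ≡ s * m ∸ s
  degree x s = sym (begin
    s * m ∸ s                                                              ≡⟨ cong (_∸ s) (sym all-vertices) ⟩
    Σ< (s * m) (λ y → adjInd x y) + s ∸ s                                  ≡⟨ m+n∸n≡m _ s ⟩
    Σ< (s * m) (λ y → adjInd x y)                                          ∎)
    where
    open ≡-Reasoning
    all-vertices : Σ< (s * m) (λ y → adjInd x y) + s ≡ s * m
    all-vertices = begin
      Σ< (s * m) (λ y → adjInd x y) + s                                    ≡⟨ cong (Σ< (s * m) (λ y → adjInd x y) +_) (sym (residue-count (x % m) s (m%n<n x m))) ⟩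
      Σ< (s * m) (λ y → adjInd x y) + Σ< (s * m) (λ y → [ x % m ≟ y % m ]) ≡⟨ sym (sum-+ (s * m) _ _) ⟩
      Σ< (s * m) (λ y → adjInd x y + [ x % m ≟ y % m ])                    ≡⟨ sum-cong (s * m) (λ y _ → adjInd-complement x y) ⟩
      Σ< (s * m) (λ _ → 1)                                                 ≡⟨ sum-const (s * m) 1 ⟩
      s * m * 1                                                            ≡⟨ *-identityʳ _ ⟩
      s * m                                                                ∎

  -- Handshake lemma: twice the number of edges is the sum of the degrees.
  edgeCount-twice : ∀ s → edgeCount (s * m) + edgeCount (s * m) ≡ s * m * (s * m ∸ s)
  edgeCount-twice s = begin
    edgeCount L + edgeCount L                                                ≡⟨ cong (edgeCount L +_) transposed ⟩
    edgeCount L + Σ< L (λ x → Σ< L (λ y → [ y <? x ] * adjInd x y))          ≡⟨ sym (sum-+ L _ _) ⟩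
    Σ< L (λ x → Σ< L (λ y → [ x <? y ] * adjInd x y) + Σ< L (λ y → [ y <? x ] * adjInd x y))
                                                                             ≡⟨ sum-cong L (λ x _ → sym (sum-+ L _ _)) ⟩
    Σ< L (λ x → Σ< L (λ y → [ x <? y ] * adjInd x y + [ y <? x ] * adjInd x y))
                                                                             ≡⟨ sum-cong L (λ x _ → sum-cong L (λ y _ → either-order x y)) ⟩
    Σ< L (λ x → Σ< L (λ y → adjInd x y))                                     ≡⟨ sum-cong L (λ x _ → degree x s) ⟩
    Σ< L (λ _ → L ∸ s)                                                       ≡⟨ sum-const L (L ∸ s) ⟩
    L * (L ∸ s)                                                              ∎
    where
    open ≡-Reasoning
    L : ℕ
    L = s * m
    either-order : ∀ x y → [ x <? y ] * adjInd x y + [ y <? x ] * adjInd x y ≡ adjInd x y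
    either-order x y with x ≟ y
    ... | yes refl rewrite adjInd-self x = cong₂ _+_ (*-zeroʳ [ x <? x ]) (*-zeroʳ [ x <? x ])
    ... | no x≢y = trans (sym (*-distribʳ-+ (adjInd x y) [ x <? y ] [ y <? x ]))
                         (trans (cong (_* adjInd x y) (<-indicators x y x≢y)) (+-identityʳ _))
    transposed : edgeCount L ≡ Σ< L (λ x → Σ< L (λ y → [ y <? x ] * adjInd x y))
    transposed = trans (sum-swap L L (λ x y → [ x <? y ] * adjInd x y))
                       (sum-cong L (λ y _ → sum-cong L (λ x _ → cong ([ x <? y ] *_) (adjInd-sym x y))))

%-absorbˡ-+ : ∀ a c N .{{_ : NonZero N}} → (a % N + c) % N ≡ (a + c) % N
%-absorbˡ-+ a c N = begin
  (a % N + c) % N         ≡⟨ %-distribˡ-+ (a % N) c N ⟩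
  (a % N % N + c % N) % N ≡⟨ cong (λ z → (z + c % N) % N) (m%n%n≡m%n a N) ⟩
  (a % N + c % N) % N     ≡⟨ sym (%-distribˡ-+ a c N) ⟩
  (a + c) % N             ∎
  where open ≡-Reasoning

multiple-below-twice : ∀ N .{{_ : NonZero N}} s → s < N + N → s % N ≡ 0 → s ≡ 0 ⊎ s ≡ N
multiple-below-twice N s s<2N s%N≡0 with s <? N
... | yes s<N = inj₁ (trans (sym (m<n⇒m%n≡m s<N)) s%N≡0)
... | no s≮N = inj₂ (trans (sym (m∸n+n≡m N≤s)) (cong (_+ N) s-N≡0))
  where
  N≤s : N ≤ s
  N≤s = ≮⇒≥ s≮N
  s-N<N : s ∸ N < N
  s-N<N = subst (s ∸ N <_) (m+n∸m≡n N N) (∸-monoˡ-< s<2N N≤s)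
  s-N≡0 : s ∸ N ≡ 0
  s-N≡0 = begin
    s ∸ N             ≡⟨ sym (m<n⇒m%n≡m s-N<N) ⟩
    (s ∸ N) % N       ≡⟨ sym ([m+n]%n≡m%n (s ∸ N) N) ⟩
    (s ∸ N + N) % N   ≡⟨ cong (_% N) (m∸n+n≡m N≤s) ⟩
    s % N             ≡⟨ s%N≡0 ⟩
    0                 ∎
    where open ≡-Reasoning

-- Hamiltonian cycles of the complete multipartite graph on N = suc N' ≥ 3
-- vertices whose parts are the residue classes mod m = suc m', represented as
-- N-periodic sequences of vertices.
module Walks (m' N' : ℕ) (N≥3 : 3 ≤ suc N') where

  open MultipartiteCounting m' public

  N : ℕ
  N = suc N'

  record HamWalk (b : ℕ → ℕ) : Set where
    field
      periodic  : ∀ i → b (i % N) ≡ b i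
      bounded   : ∀ i → b i < N
      injective : ∀ i j → i < N → j < N → b i ≡ b j → i ≡ j
      adjacent  : ∀ i → b i % m ≢ b (suc i) % m

  module HamWalkProperties {b : ℕ → ℕ} (w : HamWalk b) where
    open HamWalk w

    same-vertex⇒%≡ : ∀ u v → b u ≡ b v → u % N ≡ v % N
    same-vertex⇒%≡ u v e =
      injective (u % N) (v % N) (m%n<n u N) (m%n<n v N) (trans (periodic u) (trans e (sym (periodic v))))

    %≡⇒same-vertex : ∀ u v → u % N ≡ v % N → b u ≡ b v
    %≡⇒same-vertex u v e = trans (sym (periodic u)) (trans (cong b e) (periodic v))

    shift : ∀ u v k → b u ≡ b v → b (u + k) ≡ b (v + k)
    shift u v k e = %≡⇒same-vertex (u + k) (v + k) (begin
      (u + k) % N       ≡⟨ sym (%-absorbˡ-+ u k N) ⟩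
      (u % N + k) % N   ≡⟨ cong (λ z → (z + k) % N) (same-vertex⇒%≡ u v e) ⟩
      (v % N + k) % N   ≡⟨ %-absorbˡ-+ v k N ⟩
      (v + k) % N       ∎)
      where open ≡-Reasoning

    period : ∀ i → b (i + N) ≡ b i
    period i = %≡⇒same-vertex (i + N) i ([m+n]%n≡m%n i N)

    unshift : ∀ u v → b (suc u) ≡ b (suc v) → b u ≡ b v
    unshift u v e = begin
      b u              ≡⟨ sym (period u) ⟩
      b (u + N)        ≡⟨ cong b (+-suc u N') ⟩
      b (suc u + N')   ≡⟨ shift (suc u) (suc v) N' e ⟩
      b (suc v + N')   ≡⟨ cong b (sym (+-suc v N')) ⟩
      b (v + N)        ≡⟨ period v ⟩
      b v              ∎
      where open ≡-Reasoning

    -- Since N ≥ 3 a walk never returns after two steps.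
    no-return-in-two : ∀ i → b i ≢ b (suc (suc i))
    no-return-in-two zero e with injective 0 2 (≤-trans (s≤s z≤n) N≥3) N≥3 e
    ... | ()
    no-return-in-two (suc i) e = no-return-in-two i (unshift i (suc (suc i)) e)

  StepAt : (ℕ → ℕ) → ℕ → ℕ → ℕ → Set
  StepAt b x y i = (b i ≡ x × b (suc i) ≡ y) ⊎ (b i ≡ y × b (suc i) ≡ x)

  Traverses : (ℕ → ℕ) → ℕ → ℕ → Set
  Traverses b x y = ∃ λ i → i < N × StepAt b x y i

  stepCount : (ℕ → ℕ) → ℕ → ℕ → ℕ → ℕ
  stepCount b x y i = [ b i ≟ x ] * [ b (suc i) ≟ y ] + [ b i ≟ y ] * [ b (suc i) ≟ x ]

  multiplicity : (ℕ → ℕ) → ℕ → ℕ → ℕ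
  multiplicity b x y = Σ< N (stepCount b x y)

  stepCount≢0⇒stepAt : ∀ b x y i → stepCount b x y i ≢ 0 → StepAt b x y i
  stepCount≢0⇒stepAt b x y i nz with b i ≟ x | b (suc i) ≟ y | b i ≟ y | b (suc i) ≟ x
  ... | yes p | yes q | _     | _     = inj₁ (p , q)
  ... | _     | _     | yes p | yes q = inj₂ (p , q)
  ... | no _  | _     | no _  | _     = ⊥-elim (nz refl)
  ... | no _  | _     | yes _ | no _  = ⊥-elim (nz refl)
  ... | yes _ | no _  | no _  | _     = ⊥-elim (nz refl)
  ... | yes _ | no _  | yes _ | no _  = ⊥-elim (nz refl)

  stepAt⇒stepCount≡1 : ∀ b x y i → x ≢ y → StepAt b x y i → stepCount b x y i ≡ 1
  stepAt⇒stepCount≡1 b x y i x≢y (inj₁ (p , q)) with b i ≟ x | b (suc i) ≟ y | b i ≟ y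
  ... | yes _ | yes _ | no _ = refl
  ... | no z  | _     | _    = ⊥-elim (z p)
  ... | _     | no z  | _    = ⊥-elim (z q)
  ... | _     | _     | yes z = ⊥-elim (x≢y (trans (sym p) z))
  stepAt⇒stepCount≡1 b x y i x≢y (inj₂ (p , q)) with b i ≟ x | b i ≟ y | b (suc i) ≟ x
  ... | no _  | yes _ | yes _ = refl
  ... | yes z | _     | _     = ⊥-elim (x≢y (trans (sym z) p))
  ... | _     | no z  | _     = ⊥-elim (z p)
  ... | _     | _     | no z  = ⊥-elim (z q)

  multiplicity≢0⇒traverses : ∀ b x y → multiplicity b x y ≢ 0 → Traverses b x y
  multiplicity≢0⇒traverses b x y nz with sum-nonzero N (stepCount b x y) nz
  ... | i , i<N , c≢0 = i , i<N , stepCount≢0⇒stepAt b x y i c≢0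

  module TraversalProperties {b : ℕ → ℕ} (w : HamWalk b) where
    open HamWalk w
    open HamWalkProperties w

    traverses-step : ∀ i → Traverses b (b i) (b (suc i))
    traverses-step i = i % N , m%n<n i N , inj₁ (periodic i , (begin
      b (suc (i % N)) ≡⟨ cong b (+-comm 1 (i % N)) ⟩
      b (i % N + 1)   ≡⟨ shift (i % N) i 1 (periodic i) ⟩
      b (i + 1)       ≡⟨ cong b (+-comm i 1) ⟩
      b (suc i)       ∎))
      where open ≡-Reasoning

    stepAt-unique : ∀ x y i j → x ≢ y → i < N → j < N → StepAt b x y i → StepAt b x y j → i ≡ j
    stepAt-unique x y i j _ i<N j<N (inj₁ (p , _)) (inj₁ (p′ , _)) = injective i j i<N j<N (trans p (sym p′))
    stepAt-unique x y i j _ i<N j<N (inj₂ (p , _)) (inj₂ (p′ , _)) = injective i j i<N j<N (trans p (sym p′))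
    stepAt-unique x y i j _ _ _ (inj₁ (p , q)) (inj₂ (p′ , q′)) = ⊥-elim (opposite i j p q q′ p′)
      where
      -- b i = b (suc j) and b (suc i) = b j force b i = b (i + 2)
      opposite : ∀ i j → b i ≡ x → b (suc i) ≡ y → b (suc j) ≡ x → b j ≡ y → ⊥
      opposite i j p q q′ p′ = no-return-in-two i (sym (begin
        b (suc (suc i)) ≡⟨ cong b (+-comm 1 (suc i)) ⟩
        b (suc i + 1)   ≡⟨ shift (suc i) j 1 (trans q (sym p′)) ⟩
        b (j + 1)       ≡⟨ cong b (+-comm j 1) ⟩
        b (suc j)       ≡⟨ trans q′ (sym p) ⟩
        b i             ∎))
        where open ≡-Reasoning
    stepAt-unique x y i j x≢y i<N j<N (inj₂ s) (inj₁ s′) =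
      sym (stepAt-unique x y j i x≢y j<N i<N (inj₁ s′) (inj₂ s))

    multiplicity-traversed : ∀ x y → x ≢ y → Traverses b x y → multiplicity b x y ≡ 1
    multiplicity-traversed x y x≢y (i , i<N , s) =
      trans (sum-point N (stepCount b x y) i i<N others) (stepAt⇒stepCount≡1 b x y i x≢y s)
      where
      others : ∀ j → j < N → j ≢ i → stepCount b x y j ≡ 0
      others j j<N j≢i with stepCount b x y j ≟ 0
      ... | yes z = z
      ... | no nz = ⊥-elim (j≢i (stepAt-unique x y j i x≢y j<N i<N (stepCount≢0⇒stepAt b x y j nz) s))

    multiplicity-untraversed : ∀ x y → ¬ Traverses b x y → multiplicity b x y ≡ 0
    multiplicity-untraversed x y untraversed with multiplicity b x y ≟ 0
    ... | yes z = z
    ... | no nz = ⊥-elim (untraversed (multiplicity≢0⇒traverses b x y nz))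

    traversed-bounded : ∀ x y → Traverses b x y → x < N × y < N
    traversed-bounded x y (i , _ , inj₁ (refl , refl)) = bounded i , bounded (suc i)
    traversed-bounded x y (i , _ , inj₂ (refl , refl)) = bounded (suc i) , bounded i

    traversed-adjacent : ∀ x y → Traverses b x y → x % m ≢ y % m
    traversed-adjacent x y (i , _ , inj₁ (refl , refl)) = adjacent i
    traversed-adjacent x y (i , _ , inj₂ (refl , refl)) = λ e → adjacent i (sym e)

  _⊑_ : (ℕ → ℕ) → (ℕ → ℕ) → Set
  b ⊑ b′ = ∀ x y → Traverses b x y → Traverses b′ x y

  traverses-map : ∀ (f : ℕ → ℕ) (b : ℕ → ℕ) {x y} → Traverses b x y → Traverses (λ i → f (b i)) (f x) (f y)
  traverses-map f b (i , i<N , inj₁ (p , q)) = i , i<N , inj₁ (cong f p , cong f q)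
  traverses-map f b (i , i<N , inj₂ (p , q)) = i , i<N , inj₂ (cong f p , cong f q)

  ⊑-map : ∀ (f : ℕ → ℕ) {b b′ : ℕ → ℕ} → b ⊑ b′ → (λ i → f (b i)) ⊑ (λ i → f (b′ i))
  ⊑-map f {b} {b′} b⊑b′ x y (i , i<N , s) with b⊑b′ (b i) (b (suc i)) (i , i<N , inj₁ (refl , refl))
  ... | j , j<N , s′ = j , j<N , transport s s′
    where
    transport : StepAt (λ i → f (b i)) x y i → StepAt b′ (b i) (b (suc i)) j → StepAt (λ i → f (b′ i)) x y j
    transport (inj₁ (u , v)) (inj₁ (p , q)) = inj₁ (trans (cong f p) u , trans (cong f q) v)
    transport (inj₁ (u , v)) (inj₂ (p , q)) = inj₂ (trans (cong f p) v , trans (cong f q) u)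
    transport (inj₂ (u , v)) (inj₁ (p , q)) = inj₂ (trans (cong f p) u , trans (cong f q) v)
    transport (inj₂ (u , v)) (inj₂ (p , q)) = inj₁ (trans (cong f p) v , trans (cong f q) u)

  edgeSum : ∀ {b} → HamWalk b → (g : ℕ → ℕ → ℕ) → (∀ x y → g x y ≡ g y x) →
    Σ< N (λ i → g (b i) (b (suc i))) ≡ Σ< N (λ x → Σ< N (λ y → [ x <? y ] * multiplicity b x y * g x y))
  edgeSum {b} w g sym-g = sym (begin
    Σ< N (λ x → Σ< N (λ y → [ x <? y ] * multiplicity b x y * g x y))
      ≡⟨ sum-cong N (λ x _ → sum-cong N (λ y _ → expand x y)) ⟩
    Σ< N (λ x → Σ< N (λ y → Σ< N (λ i → weighted i x y)))
      ≡⟨ sum-cong N (λ x _ → sum-swap N N (λ y i → weighted i x y)) ⟩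
    Σ< N (λ x → Σ< N (λ i → Σ< N (λ y → weighted i x y)))
      ≡⟨ sum-swap N N (λ x i → Σ< N (λ y → weighted i x y)) ⟩
    Σ< N (λ i → Σ< N (λ x → Σ< N (λ y → weighted i x y)))
      ≡⟨ sum-cong N (λ i _ → step i) ⟩
    Σ< N (λ i → g (b i) (b (suc i))) ∎)
    where
    open ≡-Reasoning
    open HamWalk w
    weighted : ℕ → ℕ → ℕ → ℕ
    weighted i x y = [ x <? y ] * stepCount b x y i * g x y
    expand : ∀ x y → [ x <? y ] * multiplicity b x y * g x y ≡ Σ< N (λ i → weighted i x y)
    expand x y = sym (trans (sum-*ʳ N (g x y) (λ i → [ x <? y ] * stepCount b x y i))
                            (cong (_* g x y) (sum-*ˡ N [ x <? y ] (stepCount b x y))))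
    step : ∀ i → Σ< N (λ x → Σ< N (λ y → weighted i x y)) ≡ g (b i) (b (suc i))
    step i = trans (pair-indicator-sum N (b i) (b (suc i)) g (bounded i) (bounded (suc i)))
                   (ordered-pick (b i) (b (suc i)) g (λ e → adjacent i (cong (_% m) e)) (sym-g _ _))

  edgeSum-cong : ∀ {b b′} → HamWalk b → HamWalk b′ →
    b ⊑ b′ → b′ ⊑ b →
    (g : ℕ → ℕ → ℕ) → (∀ x y → g x y ≡ g y x) →
    Σ< N (λ i → g (b i) (b (suc i))) ≡ Σ< N (λ i → g (b′ i) (b′ (suc i)))
  edgeSum-cong {b} {b′} w w′ b⊑b′ b′⊑b g sym-g = begin
    Σ< N (λ i → g (b i) (b (suc i)))                                          ≡⟨ edgeSum w g sym-g ⟩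
    Σ< N (λ x → Σ< N (λ y → [ x <? y ] * multiplicity b x y * g x y))          ≡⟨ sum-cong N (λ x _ → sum-cong N (λ y _ → same x y)) ⟩
    Σ< N (λ x → Σ< N (λ y → [ x <? y ] * multiplicity b′ x y * g x y))         ≡⟨ sym (edgeSum w′ g sym-g) ⟩
    Σ< N (λ i → g (b′ i) (b′ (suc i)))                                        ∎
    where
    open ≡-Reasoning
    module T = TraversalProperties w
    module T′ = TraversalProperties w′
    same-multiplicity : ∀ x y → x ≢ y → multiplicity b x y ≡ multiplicity b′ x y
    same-multiplicity x y x≢y with multiplicity b x y ≟ 0
    ... | no nz = trans (T.multiplicity-traversed x y x≢y t) (sym (T′.multiplicity-traversed x y x≢y (b⊑b′ x y t)))
      where
      t : Traverses b x y
      t = multiplicity≢0⇒traverses b x y nz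
    ... | yes z = trans z (sym (T′.multiplicity-untraversed x y untraversed))
      where
      untraversed : ¬ Traverses b′ x y
      untraversed t′ = 1+n≢0 (trans (sym (T.multiplicity-traversed x y x≢y (b′⊑b x y t′))) z)
    same : ∀ x y → [ x <? y ] * multiplicity b x y * g x y ≡ [ x <? y ] * multiplicity b′ x y * g x y
    same x y with x <? y
    ... | no _ = refl
    ... | yes x<y = cong (λ k → 1 * k * g x y) (same-multiplicity x y (<⇒≢ x<y))

-- A cycle given as a list c = (c₀, …, c_{N-1}) is read as the N-periodic
-- walk i ↦ c_{i mod N}; its edges (Defs.EdgeOf) are exactly the edges the
-- walk traverses, and equivalent lists (Defs.SameCycle) traverse the same edges.
module ListWalks (m' N' : ℕ) (N≥3 : 3 ≤ suc N') where
  open Walks m' N' N≥3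

  walkOf : List ℕ → ℕ → ℕ
  walkOf c i = nth 0 c (i % N)

  walkOf-periodic : ∀ c i → walkOf c (i % N) ≡ walkOf c i
  walkOf-periodic c i = cong (nth 0 c) (m%n%n≡m%n i N)

  walkOf-suc : ∀ c i → walkOf c (suc (i % N)) ≡ walkOf c (suc i)
  walkOf-suc c i = cong (nth 0 c) (begin
    (1 + i % N) % N ≡⟨ cong (_% N) (+-comm 1 (i % N)) ⟩
    (i % N + 1) % N ≡⟨ %-absorbˡ-+ i 1 N ⟩
    (i + 1) % N     ≡⟨ cong (_% N) (+-comm i 1) ⟩
    (1 + i) % N     ∎)
    where open ≡-Reasoning

  walkOf-below : ∀ c i → i < N → walkOf c i ≡ nth 0 c i
  walkOf-below c i i<N = cong (nth 0 c) (m<n⇒m%n≡m i<N)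

  walkOf-map : ∀ (f : ℕ → ℕ) c → length c ≡ N → ∀ i → walkOf (map f c) i ≡ f (walkOf c i)
  walkOf-map f c len i = nth-map f 0 0 c (i % N) (subst (i % N <_) (sym len) (m%n<n i N))

  length-rotate₁ : ∀ (c₀ : ℕ) cs → length (cs ++ c₀ ∷ []) ≡ length (c₀ ∷ cs)
  length-rotate₁ c₀ cs = trans (length-++ cs) (+-comm (length cs) 1)

  steps-nth : ∀ c → length c ≡ N → ∀ i → i < N →
    nth (0 , 0) (steps c) i ≡ (walkOf c i , walkOf c (suc i))
  steps-nth (c₀ ∷ cs) len i i<N =
    trans (nth-zip 0 0 (c₀ ∷ cs) (cs ++ c₀ ∷ []) i (subst (i <_) (sym len) i<N) (subst (i <_) (sym len′) i<N))
          (cong₂ _,_ (sym (walkOf-below (c₀ ∷ cs) i i<N)) next)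
    where
    len-cs : length cs ≡ N'
    len-cs = suc-injective len
    len′ : length (cs ++ c₀ ∷ []) ≡ N
    len′ = trans (length-rotate₁ c₀ cs) len
    next : nth 0 (cs ++ c₀ ∷ []) i ≡ walkOf (c₀ ∷ cs) (suc i)
    next with suc i <? N
    ... | yes 1+i<N = trans (nth-++ˡ 0 cs (c₀ ∷ []) i (subst (i <_) (sym len-cs) (≤-pred 1+i<N)))
                            (sym (walkOf-below (c₀ ∷ cs) (suc i) 1+i<N))
    ... | no 1+i≮N = begin
      nth 0 (cs ++ c₀ ∷ []) i             ≡⟨ cong (nth 0 (cs ++ c₀ ∷ [])) (trans i≡len (sym (+-identityʳ _))) ⟩
      nth 0 (cs ++ c₀ ∷ []) (length cs + 0) ≡⟨ nth-++ʳ 0 cs (c₀ ∷ []) 0 ⟩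
      c₀                                   ≡⟨ cong (nth 0 (c₀ ∷ cs)) (sym (trans (cong (_% N) 1+i≡N) (n%n≡0 N))) ⟩
      walkOf (c₀ ∷ cs) (suc i)             ∎
      where
      open ≡-Reasoning
      i≡len : i ≡ length cs
      i≡len = trans (≤-antisym (≤-pred i<N) (≤-pred (≮⇒≥ 1+i≮N))) (sym len-cs)
      1+i≡N : suc i ≡ N
      1+i≡N = cong suc (trans i≡len len-cs)

  length-steps : ∀ c → length c ≡ N → length (steps c) ≡ N
  length-steps (c₀ ∷ cs) len = begin
    length (steps (c₀ ∷ cs))                  ≡⟨ length-zipWith _,_ (c₀ ∷ cs) (cs ++ c₀ ∷ []) ⟩
    length (c₀ ∷ cs) ⊓ length (cs ++ c₀ ∷ []) ≡⟨ cong₂ _⊓_ len (trans (length-rotate₁ c₀ cs) len) ⟩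
    N ⊓ N                                     ≡⟨ ⊓-idem N ⟩
    N                                         ∎
    where open ≡-Reasoning

  step∈steps : ∀ c → length c ≡ N → ∀ i → i < N → (walkOf c i , walkOf c (suc i)) ∈ steps c
  step∈steps c len i i<N = subst (_∈ steps c) (steps-nth c len i i<N)
    (nth∈ (0 , 0) (steps c) i (subst (i <_) (sym (length-steps c len)) i<N))

  ∈steps⇒step : ∀ c → length c ≡ N → ∀ {p} → p ∈ steps c →
    ∃ λ i → i < N × (walkOf c i , walkOf c (suc i)) ≡ p
  ∈steps⇒step c len p∈ with ∈⇒nth (0 , 0) p∈
  ... | i , i<len , e = i , i<N , trans (sym (steps-nth c len i i<N)) e
    where
    i<N : i < N
    i<N = subst (i <_) (length-steps c len) i<len

  edgeOf⇒traverses : ∀ c → length c ≡ N → ∀ x y → EdgeOf x y c → Traverses (walkOf c) x y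
  edgeOf⇒traverses c len x y (inj₁ xy∈) with ∈steps⇒step c len xy∈
  ... | i , i<N , refl = i , i<N , inj₁ (refl , refl)
  edgeOf⇒traverses c len x y (inj₂ yx∈) with ∈steps⇒step c len yx∈
  ... | i , i<N , refl = i , i<N , inj₂ (refl , refl)

  traverses⇒edgeOf : ∀ c → length c ≡ N → ∀ x y → Traverses (walkOf c) x y → EdgeOf x y c
  traverses⇒edgeOf c len x y (i , i<N , inj₁ (refl , refl)) = inj₁ (step∈steps c len i i<N)
  traverses⇒edgeOf c len x y (i , i<N , inj₂ (refl , refl)) = inj₂ (step∈steps c len i i<N)

  hamCycle⇒hamWalk : ∀ n c → m * n ≡ N → HamCycle m n c → HamWalk (walkOf c)
  hamCycle⇒hamWalk n c mn≡N (len≡mn , unique , bounded , adjacent) = record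
    { periodic = walkOf-periodic c
    ; bounded = λ i → All.lookup bounded′ (nth∈ 0 c (i % N) (subst (i % N <_) (sym len) (m%n<n i N)))
    ; injective = λ i j i<N j<N e → nth-injective 0 c unique i j (subst (i <_) (sym len) i<N) (subst (j <_) (sym len) j<N)
                    (trans (sym (walkOf-below c i i<N)) (trans e (walkOf-below c j j<N)))
    ; adjacent = adjacent′
    }
    where
    len : length c ≡ N
    len = trans len≡mn mn≡N
    bounded′ : All (_< N) c
    bounded′ = subst (λ k → All (_< k) c) mn≡N bounded
    adjacent′ : ∀ i → walkOf c i % m ≢ walkOf c (suc i) % m
    adjacent′ i = adj⇒%≢ m (walkOf c i) (walkOf c (suc i))
      (subst₂ (Adj m) (walkOf-periodic c i) (walkOf-suc c i)
        (All.lookup adjacent (step∈steps c len (i % N) (m%n<n i N))))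

  traverses-ext : ∀ {b b′ : ℕ → ℕ} → (∀ i → b i ≡ b′ i) → ∀ {x y} → Traverses b x y → Traverses b′ x y
  traverses-ext e (i , i<N , inj₁ (p , q)) = i , i<N , inj₁ (trans (sym (e i)) p , trans (sym (e (suc i))) q)
  traverses-ext e (i , i<N , inj₂ (p , q)) = i , i<N , inj₂ (trans (sym (e i)) p , trans (sym (e (suc i))) q)

  traverses-shift : ∀ c k {x y} → Traverses (λ i → walkOf c (i + k)) x y → Traverses (walkOf c) x y
  traverses-shift c k (i , _ , s) = (i + k) % N , m%n<n (i + k) N , move s
    where
    move : ∀ {x y} → StepAt (λ i → walkOf c (i + k)) x y i → StepAt (walkOf c) x y ((i + k) % N)
    move (inj₁ (p , q)) = inj₁ (trans (walkOf-periodic c (i + k)) p , trans (walkOf-suc c (i + k)) q)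
    move (inj₂ (p , q)) = inj₂ (trans (walkOf-periodic c (i + k)) p , trans (walkOf-suc c (i + k)) q)

  rotate-nth : ∀ d → length d ≡ N → ∀ k → k < N → ∀ j → j < N →
    nth 0 (rotate k d) j ≡ nth 0 d ((j + k) % N)
  rotate-nth d len k k<N j j<N with j <? N ∸ k
  ... | yes j<N-k = begin
    nth 0 (drop k d ++ take k d) j ≡⟨ nth-++ˡ 0 (drop k d) (take k d) j (subst (j <_) (sym len-drop) j<N-k) ⟩
    nth 0 (drop k d) j             ≡⟨ nth-drop 0 k d j ⟩
    nth 0 d (k + j)                ≡⟨ cong (nth 0 d) (trans (+-comm k j) (sym (m<n⇒m%n≡m j+k<N))) ⟩
    nth 0 d ((j + k) % N)          ∎
    where
    open ≡-Reasoning
    len-drop : length (drop k d) ≡ N ∸ k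
    len-drop = trans (length-drop k d) (cong (_∸ k) len)
    j+k<N : j + k < N
    j+k<N = subst (j + k <_) (m∸n+n≡m (<⇒≤ k<N)) (+-monoˡ-< k j<N-k)
  ... | no j≮N-k = begin
    nth 0 (drop k d ++ take k d) j                        ≡⟨ cong (nth 0 (drop k d ++ take k d)) j≡ ⟩
    nth 0 (drop k d ++ take k d) (length (drop k d) + j′) ≡⟨ nth-++ʳ 0 (drop k d) (take k d) j′ ⟩
    nth 0 (take k d) j′                                   ≡⟨ nth-take 0 k d j′ j′<k ⟩
    nth 0 d j′                                            ≡⟨ cong (nth 0 d) (sym j+k%N≡j′) ⟩
    nth 0 d ((j + k) % N)                                 ∎
    where
    open ≡-Reasoning
    N-k≤j : N ∸ k ≤ j
    N-k≤j = ≮⇒≥ j≮N-k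
    j′ : ℕ
    j′ = j ∸ (N ∸ k)
    j≡ : j ≡ length (drop k d) + j′
    j≡ = trans (sym (m+[n∸m]≡n N-k≤j)) (cong (_+ j′) (sym (trans (length-drop k d) (cong (_∸ k) len))))
    j′<k : j′ < k
    j′<k = subst (j′ <_) (m∸[m∸n]≡n (<⇒≤ k<N)) (∸-monoˡ-< j<N N-k≤j)
    j+k≡j′+N : j + k ≡ j′ + N
    j+k≡j′+N = begin
      j + k             ≡⟨ cong (_+ k) (sym (m∸n+n≡m N-k≤j)) ⟩
      j′ + (N ∸ k) + k  ≡⟨ +-assoc j′ (N ∸ k) k ⟩
      j′ + (N ∸ k + k)  ≡⟨ cong (j′ +_) (m∸n+n≡m (<⇒≤ k<N)) ⟩
      j′ + N            ∎
    j+k%N≡j′ : (j + k) % N ≡ j′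
    j+k%N≡j′ = trans (cong (_% N) j+k≡j′+N) (trans ([m+n]%n≡m%n j′ N) (m<n⇒m%n≡m (<-trans j′<k k<N)))

  traverses-rotate : ∀ d → length d ≡ N → ∀ k {x y} → Traverses (walkOf (rotate k d)) x y → Traverses (walkOf d) x y
  traverses-rotate d len k t with k <? N
  ... | yes k<N = traverses-shift d k (traverses-ext rotate-walk t)
    where
    rotate-walk : ∀ i → walkOf (rotate k d) i ≡ walkOf d (i + k)
    rotate-walk i = trans (rotate-nth d len k k<N (i % N) (m%n<n i N)) (cong (nth 0 d) (%-absorbˡ-+ i k N))
  ... | no k≮N = subst (λ r → Traverses (walkOf r) _ _) rotate-all t
    where
    len≤k : length d ≤ k
    len≤k = subst (_≤ k) (sym len) (≮⇒≥ k≮N)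
    rotate-all : rotate k d ≡ d
    rotate-all = cong₂ _++_ (drop-all k d len≤k) (take-all k d len≤k)

  reversed-step : ∀ (b b′ : ℕ → ℕ) {x y} i j → b i ≡ b′ (suc j) → b (suc i) ≡ b′ j →
    StepAt b x y i → StepAt b′ x y j
  reversed-step b b′ i j e₁ e₂ (inj₁ (p , q)) = inj₂ (trans (sym e₂) q , trans (sym e₁) p)
  reversed-step b b′ i j e₁ e₂ (inj₂ (p , q)) = inj₁ (trans (sym e₂) q , trans (sym e₁) p)

  reverse-entry : ∀ d → length d ≡ N → ∀ u → u < N → walkOf (reverse d) u ≡ nth 0 d (N ∸ suc u)
  reverse-entry d len u u<N = begin
    walkOf (reverse d) u        ≡⟨ walkOf-below (reverse d) u u<N ⟩
    nth 0 (reverse d) u         ≡⟨ nth-reverse 0 d u (subst (u <_) (sym len) u<N) ⟩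
    nth 0 d (length d ∸ suc u)  ≡⟨ cong (λ k → nth 0 d (k ∸ suc u)) len ⟩
    nth 0 d (N ∸ suc u)         ∎
    where open ≡-Reasoning

  reverse-inner-step : ∀ d → length d ≡ N → ∀ i → suc i < N →
    walkOf (reverse d) i ≡ walkOf d (suc (N ∸ suc (suc i))) × walkOf (reverse d) (suc i) ≡ walkOf d (N ∸ suc (suc i))
  reverse-inner-step d len i 1+i<N = first , second
    where
    open ≡-Reasoning
    j : ℕ
    j = N ∸ suc (suc i)
    1+j≡ : suc j ≡ N ∸ suc i
    1+j≡ = sym (+-∸-assoc 1 1+i<N)
    first : walkOf (reverse d) i ≡ walkOf d (suc j)
    first = begin
      walkOf (reverse d) i  ≡⟨ reverse-entry d len i (<-trans (n<1+n i) 1+i<N) ⟩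
      nth 0 d (N ∸ suc i)   ≡⟨ cong (nth 0 d) (sym 1+j≡) ⟩
      nth 0 d (suc j)       ≡⟨ sym (walkOf-below d (suc j) (subst (_< N) (sym 1+j≡) (∸-monoʳ-< {N} {suc i} {0} z<s (<⇒≤ 1+i<N)))) ⟩
      walkOf d (suc j)      ∎
    second : walkOf (reverse d) (suc i) ≡ walkOf d j
    second = trans (reverse-entry d len (suc i) 1+i<N) (sym (walkOf-below d j (∸-monoʳ-< {N} {suc (suc i)} {0} z<s 1+i<N)))

  reverse-last-step : ∀ d → length d ≡ N → walkOf (reverse d) N' ≡ walkOf d N × walkOf (reverse d) N ≡ walkOf d N'
  reverse-last-step d len = first , second
    where
    open ≡-Reasoning
    first : walkOf (reverse d) N' ≡ walkOf d N
    first = begin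
      walkOf (reverse d) N'  ≡⟨ reverse-entry d len N' ≤-refl ⟩
      nth 0 d (N' ∸ N')      ≡⟨ cong (nth 0 d) (n∸n≡0 N') ⟩
      nth 0 d 0              ≡⟨ cong (nth 0 d) (sym (n%n≡0 N)) ⟩
      walkOf d N             ∎
    second : walkOf (reverse d) N ≡ walkOf d N'
    second = begin
      walkOf (reverse d) N   ≡⟨ cong (nth 0 (reverse d)) (n%n≡0 N) ⟩
      walkOf (reverse d) 0   ≡⟨ reverse-entry d len 0 z<s ⟩
      nth 0 d N'             ≡⟨ sym (walkOf-below d N' ≤-refl) ⟩
      walkOf d N'            ∎

  traverses-reverse : ∀ d → length d ≡ N → ∀ {x y} → Traverses (walkOf (reverse d)) x y → Traverses (walkOf d) x y
  traverses-reverse d len (i , i<N , s) with suc i <? N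
  ... | yes 1+i<N = N ∸ suc (suc i) , ∸-monoʳ-< {N} {suc (suc i)} {0} z<s 1+i<N ,
    reversed-step (walkOf (reverse d)) (walkOf d) i _
      (proj₁ (reverse-inner-step d len i 1+i<N)) (proj₂ (reverse-inner-step d len i 1+i<N)) s
  ... | no 1+i≮N rewrite ≤-antisym (≤-pred i<N) (≤-pred (≮⇒≥ 1+i≮N)) = N' , ≤-refl ,
    reversed-step (walkOf (reverse d)) (walkOf d) N' N' (proj₁ (reverse-last-step d len)) (proj₂ (reverse-last-step d len)) s

  sameCycle-traverses : ∀ d e → length d ≡ N → SameCycle d e → ∀ {x y} →
    Traverses (walkOf e) x y → Traverses (walkOf d) x y
  sameCycle-traverses d e len (k , inj₁ refl) t = traverses-rotate d len k t
  sameCycle-traverses d e len (k , inj₂ refl) t =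
    traverses-reverse d len (traverses-rotate (reverse d) (trans (length-reverse d) len) k t)

module HalfTurn (m' N' h : ℕ) (N≡h+h : suc N' ≡ h + h) (m∣h : suc m' ∣ h) (N≥3 : 3 ≤ suc N') where
  open Walks m' N' N≥3

  T : ℕ → ℕ
  T v = (v + h) % N

  T-bounded : ∀ v → T v < N
  T-bounded v = m%n<n (v + h) N

  T-low : ∀ v → v < h → T v ≡ v + h
  T-low v v<h = m<n⇒m%n≡m (subst (v + h <_) (sym N≡h+h) (+-monoˡ-< h v<h))

  T-high : ∀ v → h ≤ v → v < N → T v ≡ v ∸ h
  T-high v h≤v v<N = begin
    (v + h) % N         ≡⟨ cong (λ z → (z + h) % N) (sym (m∸n+n≡m h≤v)) ⟩
    (v ∸ h + h + h) % N ≡⟨ cong (_% N) (trans (+-assoc (v ∸ h) h h) (cong (v ∸ h +_) (sym N≡h+h))) ⟩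
    (v ∸ h + N) % N     ≡⟨ [m+n]%n≡m%n (v ∸ h) N ⟩
    (v ∸ h) % N         ≡⟨ m<n⇒m%n≡m (≤-<-trans (m∸n≤m v h) v<N) ⟩
    v ∸ h               ∎
    where open ≡-Reasoning

  high⇒low : ∀ v → h ≤ v → v < N → v ∸ h < h
  high⇒low v h≤v v<N = subst (v ∸ h <_) (m+n∸m≡n h h) (∸-monoˡ-< (subst (v <_) N≡h+h v<N) h≤v)

  T-involutive : ∀ v → v < N → T (T v) ≡ v
  T-involutive v v<N = begin
    ((v + h) % N + h) % N ≡⟨ %-absorbˡ-+ (v + h) h N ⟩
    (v + h + h) % N       ≡⟨ cong (_% N) (trans (+-assoc v h h) (cong (v +_) (sym N≡h+h))) ⟩
    (v + N) % N           ≡⟨ [m+n]%n≡m%n v N ⟩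
    v % N                 ≡⟨ m<n⇒m%n≡m v<N ⟩
    v                     ∎
    where open ≡-Reasoning

  T-injective : ∀ v w → v < N → w < N → T v ≡ T w → v ≡ w
  T-injective v w v<N w<N e = trans (sym (T-involutive v v<N)) (trans (cong T e) (T-involutive w w<N))

  +h-part : ∀ x → (x + h) % m ≡ x % m
  +h-part x = %-remove-+ʳ x m∣h

  -- T preserves the parts, as m divides both h and N.
  T-part : ∀ v → T v % m ≡ v % m
  T-part v = trans (m∣n⇒o%n%m≡o%m m N (v + h) m∣N) (+h-part v)
    where
    m∣N : m ∣ N
    m∣N = subst (m ∣_) (sym N≡h+h) (∣m∣n⇒∣m+n m∣h m∣h)

  h>0 : 0 < h
  h>0 = n≢0⇒n>0 (λ h≡0 → 1+n≢0 (trans N≡h+h (cong (λ z → z + z) h≡0)))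

  T-no-fixed-point : ∀ v → v < N → T v ≢ v
  T-no-fixed-point v v<N e with v <? h
  ... | yes v<h rewrite T-low v v<h = <-irrefl (sym e) (m<m+n v h>0)
  ... | no v≮h rewrite T-high v (≮⇒≥ v≮h) v<N = <-irrefl e (∸-monoʳ-< {v} {h} {0} h>0 (≮⇒≥ v≮h))

  turn-walk : ∀ {b} → HamWalk b → HamWalk (λ i → T (b i))
  turn-walk {b} w = record
    { periodic = λ i → cong T (periodic i)
    ; bounded = λ i → T-bounded (b i)
    ; injective = λ i j i<N j<N e → injective i j i<N j<N (T-injective (b i) (b j) (bounded i) (bounded j) e)
    ; adjacent = λ i e → adjacent i (trans (sym (T-part (b i))) (trans e (T-part (b (suc i)))))
    }
    where open HamWalk w

  side : ℕ → Parity
  side v = if does (v <? h) then 0ℙ else 1ℙ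

  side-low : ∀ v → v < h → side v ≡ 0ℙ
  side-low v v<h = cong (if_then 0ℙ else 1ℙ) (dec-true (v <? h) v<h)

  side-high : ∀ v → h ≤ v → side v ≡ 1ℙ
  side-high v h≤v = cong (if_then 0ℙ else 1ℙ) (dec-false (v <? h) (≤⇒≯ h≤v))

  side-T : ∀ v → v < N → side v ⊕ side (T v) ≡ 1ℙ
  side-T v v<N with v <? h
  ... | yes v<h rewrite T-low v v<h | side-low v v<h | side-high (v + h) (m≤n+m h v) = refl
  ... | no v≮h rewrite T-high v (≮⇒≥ v≮h) v<N | side-high v (≮⇒≥ v≮h) | side-low (v ∸ h) (high⇒low v (≮⇒≥ v≮h) v<N) = refl

  crosses : ℕ → ℕ → ℕ
  crosses x y = bit (side x ⊕ side y)

  parity-crosses : ∀ x y → parity (crosses x y) ≡ side x ⊕ side y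
  parity-crosses x y = parity-bit (side x ⊕ side y)

  crossings-telescope : ∀ (b : ℕ → ℕ) k →
    parity (Σ< k (λ i → crosses (b i) (b (suc i)))) ≡ side (b 0) ⊕ side (b k)
  crossings-telescope b zero = sym (ℙ.p+p≡0ℙ (side (b 0)))
  crossings-telescope b (suc k) = begin
    parity (Σ< k c + c k)                                ≡⟨ ℙ.+-homo-+ (Σ< k c) (c k) ⟩
    parity (Σ< k c) ⊕ parity (c k)                       ≡⟨ cong₂ _⊕_ (crossings-telescope b k) (parity-crosses (b k) (b (suc k))) ⟩
    (side (b 0) ⊕ side (b k)) ⊕ (side (b k) ⊕ side (b (suc k)))
                                                         ≡⟨ ℙ.+-assoc (side (b 0)) (side (b k)) _ ⟩
    side (b 0) ⊕ (side (b k) ⊕ (side (b k) ⊕ side (b (suc k))))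
                                                         ≡⟨ cong (side (b 0) ⊕_) (sym (ℙ.+-assoc (side (b k)) (side (b k)) _)) ⟩
    side (b 0) ⊕ ((side (b k) ⊕ side (b k)) ⊕ side (b (suc k)))
                                                         ≡⟨ cong (λ z → side (b 0) ⊕ (z ⊕ side (b (suc k)))) (ℙ.p+p≡0ℙ (side (b k))) ⟩
    side (b 0) ⊕ side (b (suc k))                        ∎
    where
    open ≡-Reasoning
    c : ℕ → ℕ
    c i = crosses (b i) (b (suc i))

  -- The weight of an edge: an edge {x, y} with x low and y high has weight 1
  -- iff y - h < x; edges inside a half have weight 0. Of the two crossing
  -- edges {x, y} and {T x, T y} exactly one has weight 1 (crossWeight-turn).
  crossWeight : ℕ → ℕ → ℕ
  crossWeight x y with side x | side y
  ... | 0ℙ | 0ℙ = 0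
  ... | 1ℙ | 1ℙ = 0
  ... | 0ℙ | 1ℙ = [ y <? x + h ]
  ... | 1ℙ | 0ℙ = [ x <? y + h ]

  crossWeight-sym : ∀ x y → crossWeight x y ≡ crossWeight y x
  crossWeight-sym x y with side x | side y
  ... | 0ℙ | 0ℙ = refl
  ... | 1ℙ | 1ℙ = refl
  ... | 0ℙ | 1ℙ = refl
  ... | 1ℙ | 0ℙ = refl

  crossWeight-low : ∀ x y → x < h → y < h → crossWeight x y ≡ 0
  crossWeight-low x y x<h y<h rewrite side-low x x<h | side-low y y<h = refl

  crossWeight-high : ∀ x y → h ≤ x → h ≤ y → crossWeight x y ≡ 0
  crossWeight-high x y h≤x h≤y rewrite side-high x h≤x | side-high y h≤y = refl

  crossWeight-low-high : ∀ x y → x < h → h ≤ y → crossWeight x y ≡ [ y <? x + h ]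
  crossWeight-low-high x y x<h h≤y rewrite side-low x x<h | side-high y h≤y = refl

  crossWeight-turn : ∀ x y → x < N → y < N → x % m ≢ y % m →
    crossWeight (T x) (T y) + crossWeight x y ≡ crosses x y
  crossWeight-turn x y x<N y<N x≢y with x <? h | y <? h
  ... | yes x<h | yes y<h
    rewrite T-low x x<h | T-low y y<h | side-low x x<h | side-low y y<h
          | side-high (x + h) (m≤n+m h x) | side-high (y + h) (m≤n+m h y) = refl
  ... | no x≮h | no y≮h
    rewrite T-high x (≮⇒≥ x≮h) x<N | T-high y (≮⇒≥ y≮h) y<N
          | side-high x (≮⇒≥ x≮h) | side-high y (≮⇒≥ y≮h)
          | side-low (x ∸ h) (high⇒low x (≮⇒≥ x≮h) x<N) | side-low (y ∸ h) (high⇒low y (≮⇒≥ y≮h) y<N) = refl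
  ... | yes x<h | no y≮h
    rewrite T-low x x<h | T-high y (≮⇒≥ y≮h) y<N | side-low x x<h | side-high y (≮⇒≥ y≮h)
          | side-high (x + h) (m≤n+m h x) | side-low (y ∸ h) (high⇒low y (≮⇒≥ y≮h) y<N)
          | m∸n+n≡m (≮⇒≥ y≮h) =
    <-indicators (x + h) y (λ e → x≢y (trans (sym (+h-part x)) (cong (_% m) e)))
  ... | no x≮h | yes y<h
    rewrite T-high x (≮⇒≥ x≮h) x<N | T-low y y<h | side-high x (≮⇒≥ x≮h) | side-low y y<h
          | side-low (x ∸ h) (high⇒low x (≮⇒≥ x≮h) x<N) | side-high (y + h) (m≤n+m h y)
          | m∸n+n≡m (≮⇒≥ x≮h) =
    <-indicators (y + h) x (λ e → x≢y (sym (trans (sym (+h-part y)) (cong (_% m) e))))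

  weight : (ℕ → ℕ) → ℕ
  weight b = Σ< N (λ i → crossWeight (b i) (b (suc i)))

  -- A period of a closed walk crosses between the halves an even number of
  -- times, so the half turn preserves the parity of the weight.
  weight-turn-parity : ∀ {b} → HamWalk b → parity (weight (λ i → T (b i))) ≡ parity (weight b)
  weight-turn-parity {b} w = ⊕≡0ℙ⇒≡ _ _ (begin
    parity (weight (λ i → T (b i))) ⊕ parity (weight b)
      ≡⟨ sym (ℙ.+-homo-+ (weight (λ i → T (b i))) (weight b)) ⟩
    parity (weight (λ i → T (b i)) + weight b)
      ≡⟨ cong parity (sym (sum-+ N _ _)) ⟩
    parity (Σ< N (λ i → crossWeight (T (b i)) (T (b (suc i))) + crossWeight (b i) (b (suc i))))
      ≡⟨ cong parity (sum-cong N (λ i _ → crossWeight-turn (b i) (b (suc i)) (bounded i) (bounded (suc i)) (adjacent i))) ⟩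
    parity (Σ< N (λ i → crosses (b i) (b (suc i))))
      ≡⟨ crossings-telescope b N ⟩
    side (b 0) ⊕ side (b N)
      ≡⟨ cong (λ v → side (b 0) ⊕ side v) (period 0) ⟩
    side (b 0) ⊕ side (b 0)
      ≡⟨ ℙ.p+p≡0ℙ (side (b 0)) ⟩
    0ℙ ∎)
    where
    open ≡-Reasoning
    open HamWalk w
    open HamWalkProperties w

  -- T maps step 0 onto some step j. If the direction is kept, T shifts the
  -- whole walk by j, forcing j = h; the two half periods then contribute
  -- complementary weights and the weight is odd by crossings-telescope.
  -- If the direction is reversed, T would fix a vertex or an edge inside a part.
  module InvariantWalk {b : ℕ → ℕ} (w : HamWalk b)
      (closed : ∀ x y → Traverses b x y → Traverses b (T x) (T y)) where
    open HamWalk w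
    open HamWalkProperties w
    open TraversalProperties w

    turned-step : ∀ i → Traverses b (T (b i)) (T (b (suc i)))
    turned-step i = closed _ _ (traverses-step i)

    no-return-in-two-turned : ∀ i → T (b i) ≢ T (b (suc (suc i)))
    no-return-in-two-turned i e = no-return-in-two i (T-injective _ _ (bounded i) (bounded _) e)

    forward-next : ∀ i p → b p ≡ T (b i) → b (suc p) ≡ T (b (suc i)) → b (suc (suc p)) ≡ T (b (suc (suc i)))
    forward-next i p e₀ e₁ with turned-step (suc i)
    ... | j , _ , inj₁ (s₀ , s₁) = begin
      b (suc (suc p)) ≡⟨ cong b (+-comm 1 (suc p)) ⟩
      b (suc p + 1)   ≡⟨ shift (suc p) j 1 (trans e₁ (sym s₀)) ⟩
      b (j + 1)       ≡⟨ cong b (+-comm j 1) ⟩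
      b (suc j)       ≡⟨ s₁ ⟩
      T (b (suc (suc i))) ∎
      where open ≡-Reasoning
    ... | j , _ , inj₂ (s₀ , s₁) =
      ⊥-elim (no-return-in-two-turned i (trans (sym e₀) (trans (sym (unshift j p (trans s₁ (sym e₁)))) s₀)))

    backward-next : ∀ i p → b (suc (suc p)) ≡ T (b i) → b (suc p) ≡ T (b (suc i)) → b p ≡ T (b (suc (suc i)))
    backward-next i p e₀ e₁ with turned-step (suc i)
    ... | j , _ , inj₂ (s₀ , s₁) = trans (sym (unshift j p (trans s₁ (sym e₁)))) s₀
    ... | j , _ , inj₁ (s₀ , s₁) = ⊥-elim (no-return-in-two-turned i (begin
      T (b i)             ≡⟨ sym e₀ ⟩
      b (suc (suc p))     ≡⟨ cong b (+-comm 1 (suc p)) ⟩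
      b (suc p + 1)       ≡⟨ shift (suc p) j 1 (trans e₁ (sym s₀)) ⟩
      b (j + 1)           ≡⟨ cong b (+-comm j 1) ⟩
      b (suc j)           ≡⟨ s₁ ⟩
      T (b (suc (suc i))) ∎))
      where open ≡-Reasoning

    module Forward (j : ℕ) (j<N : j < N) (e₀ : b j ≡ T (b 0)) (e₁ : b (suc j) ≡ T (b 1)) where

      follows : ∀ i → b (j + i) ≡ T (b i) × b (suc (j + i)) ≡ T (b (suc i))
      follows zero rewrite +-identityʳ j = e₀ , e₁
      follows (suc i) rewrite +-suc j i with follows i
      ... | f₀ , f₁ = f₁ , forward-next i (j + i) f₀ f₁

      -- Shifting twice returns to b 0, so 2j ∈ {0, N}; j = 0 would make b 0 fixed by T.
      j≡h : j ≡ h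
      j≡h with multiple-below-twice N (j + j) (+-mono-< j<N j<N) (same-vertex⇒%≡ (j + j) 0 b[j+j]≡b0)
        where
        b[j+j]≡b0 : b (j + j) ≡ b 0
        b[j+j]≡b0 = trans (proj₁ (follows j)) (trans (cong T e₀) (T-involutive (b 0) (bounded 0)))
      ... | inj₂ j+j≡N = +-double-injective j h (trans j+j≡N N≡h+h)
      ... | inj₁ j+j≡0 = ⊥-elim (T-no-fixed-point (b 0) (bounded 0) (sym (subst (λ k → b k ≡ T (b 0)) (m+n≡0⇒m≡0 j j+j≡0) e₀)))

      -- The second half period is the T-image of the first, so the weight is
      -- congruent to the number of crossings of the first half, which joins
      -- b 0 to b h = T (b 0) in the other half.
      weight-odd : parity (weight b) ≡ 1ℙ
      weight-odd = begin
        parity (Σ< N f)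
          ≡⟨ cong (λ n → parity (Σ< n f)) N≡h+h ⟩
        parity (Σ< (h + h) f)
          ≡⟨ cong parity (sum-split h h f) ⟩
        parity (Σ< h f + Σ< h (λ i → f (h + i)))
          ≡⟨ cong (λ s → parity (Σ< h f + s)) (sum-cong h (λ i _ → second-half i)) ⟩
        parity (Σ< h f + Σ< h (λ i → crossWeight (T (b i)) (T (b (suc i)))))
          ≡⟨ cong parity (+-comm (Σ< h f) _) ⟩
        parity (Σ< h (λ i → crossWeight (T (b i)) (T (b (suc i)))) + Σ< h f)
          ≡⟨ cong parity (sym (sum-+ h _ _)) ⟩
        parity (Σ< h (λ i → crossWeight (T (b i)) (T (b (suc i))) + f i))
          ≡⟨ cong parity (sum-cong h (λ i _ → crossWeight-turn (b i) (b (suc i)) (bounded i) (bounded (suc i)) (adjacent i))) ⟩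
        parity (Σ< h (λ i → crosses (b i) (b (suc i))))
          ≡⟨ crossings-telescope b h ⟩
        side (b 0) ⊕ side (b h)
          ≡⟨ cong (λ v → side (b 0) ⊕ side v) b[h]≡Tb0 ⟩
        side (b 0) ⊕ side (T (b 0))
          ≡⟨ side-T (b 0) (bounded 0) ⟩
        1ℙ ∎
        where
        open ≡-Reasoning
        f : ℕ → ℕ
        f i = crossWeight (b i) (b (suc i))
        follows-h : ∀ i → b (h + i) ≡ T (b i) × b (suc (h + i)) ≡ T (b (suc i))
        follows-h = subst (λ k → ∀ i → b (k + i) ≡ T (b i) × b (suc (k + i)) ≡ T (b (suc i))) j≡h follows
        second-half : ∀ i → f (h + i) ≡ crossWeight (T (b i)) (T (b (suc i)))
        second-half i = cong₂ crossWeight (proj₁ (follows-h i)) (proj₂ (follows-h i))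
        b[h]≡Tb0 : b h ≡ T (b 0)
        b[h]≡Tb0 = trans (cong b (sym j≡h)) e₀

    module Backward (j : ℕ) (e₀ : b j ≡ T (b 1)) (e₁ : b (suc j) ≡ T (b 0)) where

      follows : ∀ i → i ≤ j → b (suc j ∸ i) ≡ T (b i) × b (j ∸ i) ≡ T (b (suc i))
      follows zero _ = e₁ , e₀
      follows (suc i) i<j with follows i (<⇒≤ i<j)
      ... | f₀ , f₁ rewrite +-∸-assoc 1 i<j | +-∸-assoc 1 (≤-trans i<j (n≤1+n j)) =
        f₁ , backward-next i (j ∸ suc i) (subst (λ k → b (suc k) ≡ T (b i)) (+-∸-assoc 1 i<j) f₀) f₁

      -- The middle of the reversed stretch is a vertex or an edge fixed by T.
      impossible : ⊥
      impossible with even-or-odd j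
      ... | k , inj₁ j≡k+k = adjacent k (begin
        b k % m             ≡⟨ cong (λ i → b i % m) (sym j-k≡k) ⟩
        b (j ∸ k) % m       ≡⟨ cong (_% m) (proj₂ (follows k k≤j)) ⟩
        T (b (suc k)) % m   ≡⟨ T-part (b (suc k)) ⟩
        b (suc k) % m       ∎)
        where
        open ≡-Reasoning
        k≤j : k ≤ j
        k≤j = subst (k ≤_) (sym j≡k+k) (m≤m+n k k)
        j-k≡k : j ∸ k ≡ k
        j-k≡k = trans (cong (_∸ k) j≡k+k) (m+n∸n≡m k k)
      ... | k , inj₂ j≡1+k+k = T-no-fixed-point (b (suc k)) (bounded (suc k))
          (sym (trans (cong b (sym j-k≡1+k)) (proj₁ (follows (suc k) 1+k≤j))))
        where
        1+k≤j : suc k ≤ j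
        1+k≤j = subst (suc k ≤_) (sym j≡1+k+k) (s≤s (m≤m+n k k))
        j-k≡1+k : j ∸ k ≡ suc k
        j-k≡1+k = trans (cong (_∸ k) j≡1+k+k) (trans (+-∸-assoc 1 (m≤n+m k k)) (cong suc (m+n∸n≡m k k)))

    weight-odd : parity (weight b) ≡ 1ℙ
    weight-odd with turned-step 0
    ... | j , j<N , inj₁ (e₀ , e₁) = Forward.weight-odd j j<N e₀ e₁
    ... | j , _ , inj₂ (e₀ , e₁) = ⊥-elim (Backward.impossible j e₀ e₁)

  crossTerm : ℕ → ℕ → ℕ
  crossTerm x y = [ x <? y ] * adjInd x y * crossWeight x y

  -- Edges from a high vertex to a larger one stay in the high half.
  crossTerm-high : ∀ x y → crossTerm (h + x) y ≡ 0
  crossTerm-high x y with h + x <? y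
  ... | no _ = refl
  ... | yes h+x<y rewrite crossWeight-high (h + x) y (m≤m+n h x) (≤-trans (m≤m+n h x) (<⇒≤ h+x<y)) =
    *-zeroʳ (1 * adjInd (h + x) y)

  crossTerm-low : ∀ x y → x < h → y < h → crossTerm x y ≡ 0
  crossTerm-low x y x<h y<h =
    trans (cong ([ x <? y ] * adjInd x y *_) (crossWeight-low x y x<h y<h)) (*-zeroʳ ([ x <? y ] * adjInd x y))

  crossTerm-crossing : ∀ x z → x < h → crossTerm x (h + z) ≡ [ z <? x ] * adjInd x z
  crossTerm-crossing x z x<h with x <? h + z
  ... | no x≮h+z = ⊥-elim (x≮h+z (≤-trans x<h (m≤m+n h z)))
  ... | yes _ = begin
    1 * adjInd x (h + z) * crossWeight x (h + z)  ≡⟨ cong₂ (λ a c → 1 * a * c) adjInd-shift weight-shift ⟩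
    1 * adjInd x z * [ z <? x ]                   ≡⟨ cong (_* [ z <? x ]) (*-identityˡ (adjInd x z)) ⟩
    adjInd x z * [ z <? x ]                       ≡⟨ *-comm (adjInd x z) [ z <? x ] ⟩
    [ z <? x ] * adjInd x z                       ∎
    where
    open ≡-Reasoning
    adjInd-shift : adjInd x (h + z) ≡ adjInd x z
    adjInd-shift = cong (λ r → [ ¬? (x % m ≟ r) ]) (trans (cong (_% m) (+-comm h z)) (+h-part z))
    weight-shift : crossWeight x (h + z) ≡ [ z <? x ]
    weight-shift = begin
      crossWeight x (h + z)   ≡⟨ crossWeight-low-high x (h + z) x<h (m≤m+n h z) ⟩
      [ h + z <? x + h ]      ≡⟨ cong (λ a → [ a <? x + h ]) (+-comm h z) ⟩
      [ z + h <? x + h ]      ≡⟨ <-indicator-+ʳ z x h ⟩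
      [ z <? x ]              ∎

  -- Summed over all edges, the weight counts the edges inside the low half:
  -- the edge {x, h + z} with z < x corresponds to the edge {z, x}.
  crossWeight-total : edgeTotal N crossWeight ≡ edgeCount h
  crossWeight-total = begin
    edgeTotal N crossWeight                            ≡⟨ cong (λ n → edgeTotal n crossWeight) N≡h+h ⟩
    Σ< (h + h) row                                     ≡⟨ sum-split h h row ⟩
    Σ< h row + Σ< h (λ x → row (h + x))                ≡⟨ cong (Σ< h row +_) (sum-zero h (λ x _ → sum-zero (h + h) (λ y _ → crossTerm-high x y))) ⟩
    Σ< h row + 0                                       ≡⟨ +-identityʳ _ ⟩
    Σ< h row                                           ≡⟨ sum-cong h (λ x x<h → low-row x x<h) ⟩
    Σ< h (λ x → Σ< h (λ z → [ z <? x ] * adjInd x z))  ≡⟨ sum-swap h h (λ x z → [ z <? x ] * adjInd x z) ⟩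
    Σ< h (λ z → Σ< h (λ x → [ z <? x ] * adjInd x z))  ≡⟨ sum-cong h (λ z _ → sum-cong h (λ x _ → cong ([ z <? x ] *_) (adjInd-sym x z))) ⟩
    edgeCount h                                        ∎
    where
    open ≡-Reasoning
    row : ℕ → ℕ
    row x = Σ< (h + h) (crossTerm x)
    low-row : ∀ x → x < h → row x ≡ Σ< h (λ z → [ z <? x ] * adjInd x z)
    low-row x x<h = begin
      row x                                                  ≡⟨ sum-split h h (crossTerm x) ⟩
      Σ< h (crossTerm x) + Σ< h (λ z → crossTerm x (h + z))  ≡⟨ cong₂ _+_ (sum-zero h (λ y y<h → crossTerm-low x y x<h y<h))
                                                                          (sum-cong h (λ z _ → crossTerm-crossing x z x<h)) ⟩
      0 + Σ< h (λ z → [ z <? x ] * adjInd x z)               ∎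

module CyclicSystem (m' n'' h : ℕ) (mn≡h+h : suc m' * suc n'' ≡ h + h) (m∣h : suc m' ∣ h)
    (N≥3 : 3 ≤ suc m' * suc n'') (Cs : List (List ℕ)) (cyclicHCS : CyclicHCS (suc m') (suc n'') Cs) where

  N' : ℕ
  N' = n'' + m' * suc n''

  open Walks m' N' N≥3
  open ListWalks m' N' N≥3
  open HalfTurn m' N' h mn≡h+h m∣h N≥3
  open TraversalProperties using (traversed-bounded; traversed-adjacent; multiplicity-traversed; multiplicity-untraversed)

  n K : ℕ
  n = suc n''
  K = length Cs

  hcs : HCS m n Cs
  hcs = proj₁ cyclicHCS

  cycle : ℕ → List ℕ
  cycle k = nth [] Cs k

  walk : ℕ → ℕ → ℕ
  walk k = walkOf (cycle k)

  cycle-ham : ∀ k → k < K → HamCycle m n (cycle k)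
  cycle-ham k k<K = All.lookup (proj₁ hcs) (nth∈ [] Cs k k<K)

  cycle-length : ∀ k → k < K → length (cycle k) ≡ N
  cycle-length k k<K = proj₁ (cycle-ham k k<K)

  walk-ham : ∀ k → k < K → HamWalk (walk k)
  walk-ham k k<K = hamCycle⇒hamWalk n (cycle k) refl (cycle-ham k k<K)

  edgeOf-cycle : ∀ k (k<K : k < K) {x y} → Traverses (walk k) x y → EdgeOf x y (lookup Cs (fromℕ< k<K))
  edgeOf-cycle k k<K t = subst (EdgeOf _ _) (sym (trans (nth-lookup [] Cs (fromℕ< k<K)) (cong cycle (toℕ-fromℕ< k<K))))
    (traverses⇒edgeOf (cycle k) (cycle-length k k<K) _ _ t)

  owner : ∀ x y → x < N → y < N → x % m ≢ y % m →
    Σ (Fin K) λ i → EdgeOf x y (lookup Cs i) × (∀ j → EdgeOf x y (lookup Cs j) → j ≡ i)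
  owner x y x<N y<N x≢y = proj₂ hcs x y x<N y<N (%≢⇒adj m x y x≢y)

  cycle-unique : ∀ j k x y → j < K → k < K → Traverses (walk j) x y → Traverses (walk k) x y → j ≡ k
  cycle-unique j k x y j<K k<K tj tk with traversed-bounded (walk-ham j j<K) x y tj
  ... | x<N , y<N with owner x y x<N y<N (traversed-adjacent (walk-ham j j<K) x y tj)
  ...   | _ , _ , only = begin
    j                 ≡⟨ sym (toℕ-fromℕ< j<K) ⟩
    toℕ (fromℕ< j<K)  ≡⟨ cong toℕ (trans (only (fromℕ< j<K) (edgeOf-cycle j j<K tj)) (sym (only (fromℕ< k<K) (edgeOf-cycle k k<K tk)))) ⟩
    toℕ (fromℕ< k<K)  ≡⟨ toℕ-fromℕ< k<K ⟩
    k                 ∎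
    where open ≡-Reasoning

  multiplicity-total : ∀ x y → x < N → y < N → Σ< K (λ k → multiplicity (walk k) x y) ≡ adjInd x y
  multiplicity-total x y x<N y<N with x % m ≟ y % m
  ... | yes same-part = sum-zero K (λ k k<K → multiplicity-untraversed (walk-ham k k<K) x y
                                     (λ t → traversed-adjacent (walk-ham k k<K) x y t same-part))
  ... | no different with owner x y x<N y<N different
  ...   | i , edge , _ = trans (sum-point K (λ k → multiplicity (walk k) x y) (toℕ i) (toℕ<n i) others)
                               (multiplicity-traversed (walk-ham (toℕ i) (toℕ<n i)) x y (λ e → different (cong (_% m) e)) tᵢ)
    where
    tᵢ : Traverses (walk (toℕ i)) x y
    tᵢ = edgeOf⇒traverses (cycle (toℕ i)) (cycle-length (toℕ i) (toℕ<n i)) x y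
           (subst (EdgeOf x y) (nth-lookup [] Cs i) edge)
    others : ∀ k → k < K → k ≢ toℕ i → multiplicity (walk k) x y ≡ 0
    others k k<K k≢i with multiplicity (walk k) x y ≟ 0
    ... | yes z = z
    ... | no nz = ⊥-elim (k≢i (cycle-unique k (toℕ i) x y k<K (toℕ<n i) (multiplicity≢0⇒traverses (walk k) x y nz) tᵢ))

  system-edgeSum : ∀ (g : ℕ → ℕ → ℕ) → (∀ x y → g x y ≡ g y x) →
    Σ< K (λ k → Σ< N (λ i → g (walk k i) (walk k (suc i)))) ≡ edgeTotal N g
  system-edgeSum g sym-g = begin
    Σ< K (λ k → Σ< N (λ i → g (walk k i) (walk k (suc i))))
      ≡⟨ sum-cong K (λ k k<K → edgeSum (walk-ham k k<K) g sym-g) ⟩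
    Σ< K (λ k → Σ< N (λ x → Σ< N (λ y → [ x <? y ] * multiplicity (walk k) x y * g x y)))
      ≡⟨ sum-swap K N _ ⟩
    Σ< N (λ x → Σ< K (λ k → Σ< N (λ y → [ x <? y ] * multiplicity (walk k) x y * g x y)))
      ≡⟨ sum-cong N (λ x _ → sum-swap K N _) ⟩
    Σ< N (λ x → Σ< N (λ y → Σ< K (λ k → [ x <? y ] * multiplicity (walk k) x y * g x y)))
      ≡⟨ sum-cong N (λ x x<N → sum-cong N (λ y y<N → pair x y x<N y<N)) ⟩
    edgeTotal N g ∎
    where
    open ≡-Reasoning
    pair : ∀ x y → x < N → y < N →
      Σ< K (λ k → [ x <? y ] * multiplicity (walk k) x y * g x y) ≡ [ x <? y ] * adjInd x y * g x y
    pair x y x<N y<N = begin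
      Σ< K (λ k → [ x <? y ] * multiplicity (walk k) x y * g x y)   ≡⟨ sum-*ʳ K (g x y) _ ⟩
      Σ< K (λ k → [ x <? y ] * multiplicity (walk k) x y) * g x y   ≡⟨ cong (_* g x y) (sum-*ˡ K [ x <? y ] _) ⟩
      [ x <? y ] * Σ< K (λ k → multiplicity (walk k) x y) * g x y   ≡⟨ cong (λ s → [ x <? y ] * s * g x y) (multiplicity-total x y x<N y<N) ⟩
      [ x <? y ] * adjInd x y * g x y                               ∎

  succMod-below : ∀ v → v < N → succMod N v ≡ suc v % N
  succMod-below v v<N with suc v ≟ N
  ... | yes 1+v≡N = sym (trans (cong (_% N) 1+v≡N) (n%n≡0 N))
  ... | no 1+v≢N = sym (m<n⇒m%n≡m (≤∧≢⇒< v<N 1+v≢N))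

  succMod-iterate : ∀ j v → v < N → fold v (succMod N) j ≡ (v + j) % N
  succMod-iterate zero v v<N = sym (trans (cong (_% N) (+-identityʳ v)) (m<n⇒m%n≡m v<N))
  succMod-iterate (suc j) v v<N rewrite succMod-iterate j v v<N = begin
    succMod N ((v + j) % N)  ≡⟨ succMod-below ((v + j) % N) (m%n<n (v + j) N) ⟩
    suc ((v + j) % N) % N    ≡⟨ cong (_% N) (+-comm 1 ((v + j) % N)) ⟩
    ((v + j) % N + 1) % N    ≡⟨ %-absorbˡ-+ (v + j) 1 N ⟩
    (v + j + 1) % N          ≡⟨ cong (_% N) (trans (+-assoc v j 1) (cong (v +_) (+-comm j 1))) ⟩
    (v + suc j) % N          ∎
    where open ≡-Reasoning

  translate-exists : ∀ k → k < K → ∃ λ j → j < K × (λ i → succMod N (walk k i)) ⊑ walk j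
  translate-exists k k<K with proj₂ cyclicHCS (cycle k) (nth∈ [] Cs k k<K)
  ... | d , d∈Cs , same with ∈⇒nth [] d∈Cs
  ...   | j , j<K , cycle-j≡d = j , j<K , λ x y t →
    subst (λ c → Traverses (walkOf c) x y) (sym cycle-j≡d)
      (sameCycle-traverses d _ (subst (λ c → length c ≡ N) cycle-j≡d (cycle-length j j<K)) same
        (traverses-ext (λ i → sym (walkOf-map (succMod N) (cycle k) (cycle-length k k<K) i)) t))

  σ : ℕ → ℕ
  σ k with k <? K
  ... | yes k<K = proj₁ (translate-exists k k<K)
  ... | no _ = 0

  σ-translate : ∀ k → k < K → σ k < K × (λ i → succMod N (walk k i)) ⊑ walk (σ k)
  σ-translate k k<K with k <? K
  ... | yes k<K′ = proj₂ (translate-exists k k<K′)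
  ... | no k≮K = ⊥-elim (k≮K k<K)

  σ-iterate : ∀ j k → k < K → fold k σ j < K × (λ i → fold (walk k i) (succMod N) j) ⊑ walk (fold k σ j)
  σ-iterate zero k k<K = k<K , λ x y t → t
  σ-iterate (suc j) k k<K with σ-iterate j k k<K
  ... | k′<K , ⊑k′ = proj₁ (σ-translate _ k′<K) , λ x y t → proj₂ (σ-translate _ k′<K) x y (⊑-map (succMod N) ⊑k′ x y t)

  -- The half turn permutes the cycles: τ k is the index of the translate of
  -- cycle k by h.
  τ : ℕ → ℕ
  τ k = fold k σ h

  τ-turn : ∀ k → k < K → τ k < K × (λ i → T (walk k i)) ⊑ walk (τ k)
  τ-turn k k<K with σ-iterate h k k<K
  ... | τk<K , ⊑τk = τk<K , λ x y t → ⊑τk x y (traverses-ext (λ i → sym (succMod-iterate h (walk k i) (bounded i))) t)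
    where open HamWalk (walk-ham k k<K)

  τ-bounded : ∀ k → k < K → τ k < K
  τ-bounded k k<K = proj₁ (τ-turn k k<K)

  τ-traverses : ∀ k → k < K → ∀ {x y} → Traverses (walk k) x y → Traverses (walk (τ k)) (T x) (T y)
  τ-traverses k k<K t = proj₂ (τ-turn k k<K) _ _ (traverses-map T (walk k) t)

  -- τ is an involution: the first edge of cycle k, turned twice, lies on
  -- cycle τ (τ k).
  τ-involution : Involution K τ
  τ-involution = record { closed = τ-bounded ; involutive = involutive }
    where
    involutive : ∀ k → k < K → τ (τ k) ≡ k
    involutive k k<K = cycle-unique (τ (τ k)) k (walk k 0) (walk k 1) (τ-bounded (τ k) (τ-bounded k k<K)) k<K
      (subst₂ (Traverses (walk (τ (τ k)))) (T-involutive (walk k 0) (bounded 0)) (T-involutive (walk k 1) (bounded 1))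
        (τ-traverses (τ k) (τ-bounded k k<K) (τ-traverses k k<K first-step)))
      first-step
      where
      open HamWalk (walk-ham k k<K)
      first-step : Traverses (walk k) (walk k 0) (walk k 1)
      first-step = 0 , z<s , inj₁ (refl , refl)

  -- Paired cycles have weights of equal parity: cycle τ k has the same edges
  -- as the half turn of cycle k.
  weight-paired : ∀ k → k < K → parity (weight (walk (τ k))) ≡ parity (weight (walk k))
  weight-paired k k<K = trans (cong parity (edgeSum-cong (walk-ham (τ k) (τ-bounded k k<K)) (turn-walk (walk-ham k k<K))
                                           ⊑turned (proj₂ (τ-turn k k<K)) crossWeight crossWeight-sym))
                              (weight-turn-parity (walk-ham k k<K))
    where
    -- the reverse inclusion comes from τ (τ k) = k
    ⊑turned : walk (τ k) ⊑ (λ i → T (walk k i))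
    ⊑turned x y t with traversed-bounded (walk-ham (τ k) (τ-bounded k k<K)) x y t
    ... | x<N , y<N = subst₂ (Traverses (λ i → T (walk k i))) (T-involutive x x<N) (T-involutive y y<N)
      (traverses-map T (walk k) (subst (λ j → Traverses (walk j) (T x) (T y)) (Involution.involutive τ-involution k k<K)
        (τ-traverses (τ k) (τ-bounded k k<K) t)))

  weight-fixed : ∀ k → k < K → τ k ≡ k → parity (weight (walk k)) ≡ 1ℙ
  weight-fixed k k<K τk≡k = InvariantWalk.weight-odd (walk-ham k k<K) invariant
    where
    invariant : ∀ x y → Traverses (walk k) x y → Traverses (walk k) (T x) (T y)
    invariant x y t = subst (λ j → Traverses (walk j) (T x) (T y)) τk≡k (τ-traverses k k<K t)

  -- The parity count: Σ_k (weight k + 1) is even by pairing-even, while the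
  -- weights add up to edgeCount h.
  total-parity : parity (edgeCount h + K) ≡ 0ℙ
  total-parity = begin
    parity (edgeCount h + K)                   ≡⟨ cong parity (sym total) ⟩
    parity (Σ< K (λ k → weight (walk k) + 1))  ≡⟨ pairing-even K _ τ τ-involution even-fixed same-parity ⟩
    0ℙ                                         ∎
    where
    open ≡-Reasoning
    total : Σ< K (λ k → weight (walk k) + 1) ≡ edgeCount h + K
    total = trans (sum-+ K (λ k → weight (walk k)) (λ _ → 1))
                  (cong₂ _+_ (trans (system-edgeSum crossWeight crossWeight-sym) crossWeight-total)
                             (trans (sum-const K 1) (*-identityʳ K)))
    parity+1 : ∀ k → parity (weight (walk k) + 1) ≡ parity (weight (walk k)) ⊕ 1ℙ
    parity+1 k = ℙ.+-homo-+ (weight (walk k)) 1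
    even-fixed : ∀ k → k < K → τ k ≡ k → parity (weight (walk k) + 1) ≡ 0ℙ
    even-fixed k k<K τk≡k = trans (parity+1 k) (cong (_⊕ 1ℙ) (weight-fixed k k<K τk≡k))
    same-parity : ∀ k → k < K → parity (weight (walk k) + 1) ≡ parity (weight (walk (τ k)) + 1)
    same-parity k k<K = trans (parity+1 k) (trans (cong (_⊕ 1ℙ) (sym (weight-paired k k<K))) (sym (parity+1 (τ k))))

  -- Counting edges: the K cycles have N edges each and cover every edge once.
  cycle-count : K * N ≡ edgeCount N
  cycle-count = begin
    K * N                                         ≡⟨ cong (K *_) (sym (trans (sum-const N 1) (*-identityʳ N))) ⟩
    K * Σ< N (λ _ → 1)                            ≡⟨ sym (sum-const K (Σ< N (λ _ → 1))) ⟩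
    Σ< K (λ k → Σ< N (λ i → 1))                   ≡⟨ system-edgeSum (λ _ _ → 1) (λ _ _ → refl) ⟩
    edgeTotal N (λ _ _ → 1)                       ≡⟨ sum-cong N (λ x _ → sum-cong N (λ y _ → *-identityʳ _)) ⟩
    edgeCount N                                   ∎
    where open ≡-Reasoning

parity-odd : ∀ z → parity (1 + 2 * z) ≡ 1ℙ
parity-odd z = trans (ℙ.+-homo-+ 1 (2 * z)) (cong (1ℙ ⊕_) (ℙ.*-homo-* 2 z))

twice-odd : ∀ n → n % 4 ≡ 2 → n ≡ (1 + 2 * (n / 4)) + (1 + 2 * (n / 4))
twice-odd n n%4≡2 = begin
  n                                         ≡⟨ m≡m%n+[m/n]*n n 4 ⟩
  n % 4 + n / 4 * 4                         ≡⟨ cong (_+ n / 4 * 4) n%4≡2 ⟩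
  2 + n / 4 * 4                             ≡⟨ rearrange (n / 4) ⟩
  (1 + 2 * (n / 4)) + (1 + 2 * (n / 4))     ∎
  where
  open ≡-Reasoning
  rearrange : ∀ q → 2 + q * 4 ≡ (1 + 2 * q) + (1 + 2 * q)
  rearrange = solve-∀

residue-0-or-3 : ∀ m' → suc m' % 4 ≡ 0 ⊎ suc m' % 4 ≡ 3 → ∃ λ r → m' ≡ 3 + 4 * r ⊎ m' ≡ 2 + 4 * r
residue-0-or-3 m' m%4 with suc m' / 4 | m≡m%n+[m/n]*n (suc m') 4
residue-0-or-3 m' (inj₁ m%4≡0) | zero | m≡ = ⊥-elim (1+n≢0 (trans m≡ (cong (_+ 0) m%4≡0)))
residue-0-or-3 m' (inj₁ m%4≡0) | suc p | m≡ =
  p , inj₁ (suc-injective (trans m≡ (trans (cong (_+ suc p * 4) m%4≡0) (cong (4 +_) (*-comm p 4)))))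
residue-0-or-3 m' (inj₂ m%4≡3) | p | m≡ =
  p , inj₂ (suc-injective (trans m≡ (trans (cong (_+ p * 4) m%4≡3) (cong (3 +_) (*-comm p 4)))))

cycle-number : ∀ m' t K E → 1 ≤ t →
  K * ((t + t) * suc m') ≡ E → E + E ≡ (t + t) * suc m' * ((t + t) * suc m' ∸ (t + t)) → K ≡ t * m'
cycle-number m' t K E t≥1 KN≡E 2E≡ = +-double-injective K (t * m')
  (*-cancelˡ-≡ (K + K) (t * m' + t * m') N {{>-nonZero N>0}} (begin
    N * (K + K)                ≡⟨ *-distribˡ-+ N K K ⟩
    N * K + N * K              ≡⟨ cong₂ _+_ NK≡E NK≡E ⟩
    E + E                      ≡⟨ 2E≡ ⟩
    N * (N ∸ (t + t))          ≡⟨ cong (N *_) N-2t ⟩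
    N * ((t + t) * m')         ≡⟨ cong (N *_) (*-distribʳ-+ m' t t) ⟩
    N * (t * m' + t * m')      ∎))
  where
  open ≡-Reasoning
  N : ℕ
  N = (t + t) * suc m'
  NK≡E : N * K ≡ E
  NK≡E = trans (*-comm N K) KN≡E
  N>0 : 0 < N
  N>0 = *-mono-≤ {1} {t + t} {1} {suc m'} (≤-trans t≥1 (m≤m+n t t)) (s≤s z≤n)
  N-2t : N ∸ (t + t) ≡ (t + t) * m'
  N-2t = trans (cong (_∸ (t + t)) (*-suc (t + t) m')) (m+n∸m≡n (t + t) _)

odd-if-double : ∀ w z → w + w ≡ (1 + 2 * z) + (1 + 2 * z) → parity w ≡ 1ℙ
odd-if-double w z e = trans (cong parity (+-double-injective w (1 + 2 * z) e)) (parity-odd z)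

-- For t = 1 + 2u odd and m ≡ 0, 3 (mod 4), B + t·m' is odd, where 2B = t·m·(t·m - t)
-- is twice the number of edges of K_{m×t}.
odd-total : ∀ u m' r B → (m' ≡ 3 + 4 * r ⊎ m' ≡ 2 + 4 * r) →
  B + B ≡ (1 + 2 * u) * suc m' * ((1 + 2 * u) * suc m' ∸ (1 + 2 * u)) → parity (B + (1 + 2 * u) * m') ≡ 1ℙ
odd-total u m' r B m'≡ 2B≡ = odd-if-double (B + K) (Z m'≡) (begin
  (B + K) + (B + K)                  ≡⟨ interchange B K B K ⟩
  (B + B) + (K + K)                  ≡⟨ cong (_+ (K + K)) (trans 2B≡ (cong (t * suc m' *_) tm-t≡K)) ⟩
  t * suc m' * K + (K + K)           ≡⟨ identity m'≡ ⟩
  (1 + 2 * Z m'≡) + (1 + 2 * Z m'≡)  ∎)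
  where
  open ≡-Reasoning
  t K : ℕ
  t = 1 + 2 * u
  K = t * m'
  tm-t≡K : t * suc m' ∸ t ≡ K
  tm-t≡K = trans (cong (_∸ t) (*-suc t m')) (m+n∸m≡n t K)
  Z : m' ≡ 3 + 4 * r ⊎ m' ≡ 2 + 4 * r → ℕ
  Z (inj₁ _) = (1 + r) * t * t * (3 + 4 * r) + (1 + 2 * r + 3 * u + 4 * u * r)
  Z (inj₂ _) = 1 + 5 * r + 4 * r * r + (2 * u + 2 * u * u) * (3 + 10 * r + 8 * r * r) + t * (1 + 2 * r)
  identity : ∀ e → t * suc m' * K + (K + K) ≡ (1 + 2 * Z e) + (1 + 2 * Z e)
  identity (inj₁ refl) = mod4≡0 u r
    where
    mod4≡0 : ∀ u r → (1 + 2 * u) * suc (3 + 4 * r) * ((1 + 2 * u) * (3 + 4 * r)) + ((1 + 2 * u) * (3 + 4 * r) + (1 + 2 * u) * (3 + 4 * r))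
      ≡ (1 + 2 * ((1 + r) * (1 + 2 * u) * (1 + 2 * u) * (3 + 4 * r) + (1 + 2 * r + 3 * u + 4 * u * r)))
        + (1 + 2 * ((1 + r) * (1 + 2 * u) * (1 + 2 * u) * (3 + 4 * r) + (1 + 2 * r + 3 * u + 4 * u * r)))
    mod4≡0 = solve-∀
  identity (inj₂ refl) = mod4≡3 u r
    where
    mod4≡3 : ∀ u r → (1 + 2 * u) * suc (2 + 4 * r) * ((1 + 2 * u) * (2 + 4 * r)) + ((1 + 2 * u) * (2 + 4 * r) + (1 + 2 * u) * (2 + 4 * r))
      ≡ (1 + 2 * (1 + 5 * r + 4 * r * r + (2 * u + 2 * u * u) * (3 + 10 * r + 8 * r * r) + (1 + 2 * u) * (1 + 2 * r)))
        + (1 + 2 * (1 + 5 * r + 4 * r * r + (2 * u + 2 * u * u) * (3 + 10 * r + 8 * r * r) + (1 + 2 * u) * (1 + 2 * r)))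
    mod4≡3 = solve-∀

-- With n = 2t, t = 1 + 2u and h = tm, a cyclic system would make
-- edgeCount h + K even (total-parity), while K = t(m - 1) (cycle-number) and
-- edgeCount h + K is odd (odd-total).
corollary3p4 : (m n : ℕ) → 2 ≤ m → 1 ≤ n → 2 ∣ n →
    (m % 4 ≡ 0 ⊎ m % 4 ≡ 3) → n % 4 ≡ 2 →
    ¬ (∃ λ (Cs : List (List ℕ)) → CyclicHCS m n Cs)
corollary3p4 (suc m') (suc n'') m≥2 _ _ m%4 n%4 (Cs , cyclic) with residue-0-or-3 m' m%4
... | r , m'≡ = ℙ.p≢p⁻¹ 1ℙ (begin
  1ℙ                             ≡⟨ sym (odd-total u m' r (edgeCount h) m'≡ (edgeCount-twice t)) ⟩
  parity (edgeCount h + t * m')  ≡⟨ cong (λ k → parity (edgeCount h + k)) (sym K≡tm') ⟩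
  parity (edgeCount h + K)       ≡⟨ total-parity ⟩
  0ℙ                             ∎)
  where
  open ≡-Reasoning
  u t h : ℕ
  u = suc n'' / 4
  t = 1 + 2 * u
  n≡t+t : suc n'' ≡ t + t
  n≡t+t = twice-odd (suc n'') n%4
  h = t * suc m'
  mn≡h+h : suc m' * suc n'' ≡ h + h
  mn≡h+h = trans (cong (suc m' *_) n≡t+t) (trans (*-distribˡ-+ (suc m') t t) (cong₂ _+_ (*-comm (suc m') t) (*-comm (suc m') t)))
  N≥3 : 3 ≤ suc m' * suc n''
  N≥3 = ≤-trans (n≤1+n 3) (*-mono-≤ m≥2 (subst (2 ≤_) (sym n≡t+t) (+-mono-≤ {1} {t} {1} {t} (s≤s z≤n) (s≤s z≤n))))
  open CyclicSystem m' n'' h mn≡h+h (divides t refl) N≥3 Cs cyclic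
  open MultipartiteCounting m' using (edgeCount; edgeCount-twice)
  N≡ : suc m' * suc n'' ≡ (t + t) * suc m'
  N≡ = trans (cong (suc m' *_) n≡t+t) (*-comm (suc m') (t + t))
  K≡tm' : K ≡ t * m'
  K≡tm' = cycle-number m' t K (edgeCount ((t + t) * suc m')) (s≤s z≤n)
    (subst (λ N → K * N ≡ edgeCount N) N≡ cycle-count) (edgeCount-twice (t + t))
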